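{- Consider walks with steps in $\{(1,1),(1,-1),(-1,1),(-1,-1)\}$ on the slit plane. For $n\ge1$, the number of such walks of length $2n$ going from $(0,0)$ to $(2,0)$ is $\frac12\,4^nC_n$. More precisely, for $1\le m\le n$, the number of such walks having exactly $2m-1$ steps in the set $\{(-1,-1),(1,1)\}$ is $$\frac12\,\frac{4^n}{n}\binom nm\binom n{m-1}.$$
   Context: A walk is a finite sequence $(w_0,\dots,w_n)$ of points of $\mathbb Z^2$ with $w_0=(0,0)$ and each $w_k-w_{k-1}$ a step; $n$ is its length. It is on the slit plane if none of $w_1,\dots,w_n$ lies on $\mathcal H=\{(k,0):k\le0\}$. $C_n=\frac1{n+1}\binom{2n}n$. -}

module Defs where

open import Data.Bool using (Bool; true; false; _∧_; not)
open import Data.Nat as ℕ using (ℕ; zero; suc; _*_; _∸_; _/_)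
open import Data.Nat.Combinatorics using (_C_)
open import Data.Integer as ℤ using (ℤ; +_; -[1+_])
open import Data.Product using (_×_; _,_)
open import Data.List using (List; []; _∷_; length; filterᵇ; concatMap; map)
open import Relation.Nullary.Decidable using (⌊_⌋)

data Step : Set where
  pp : Step
  pm : Step
  mp : Step
  mm : Step

allSteps : List Step
allSteps = pp ∷ pm ∷ mp ∷ mm ∷ []

vec : Step → ℤ × ℤ
vec pp = ( + 1 , + 1 )
vec pm = ( + 1 , -[1+ 0 ] )
vec mp = ( -[1+ 0 ] , + 1 )
vec mm = ( -[1+ 0 ] , -[1+ 0 ] )

Point : Set
Point = ℤ × ℤ

_⊕_ : Point → Step → Point
(x , y) ⊕ s with vec s
... | (a , b) = (x ℤ.+ a , y ℤ.+ b)

inH : Point → Bool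
inH (x , y) = ⌊ y ℤ.≟ + 0 ⌋ ∧ ⌊ x ℤ.≤? + 0 ⌋

-- a walk is its list of steps, started at (0,0); w_k = w_{k-1} + step_k
-- avoids p ss : none of the points visited after leaving p lies on H
avoids : Point → List Step → Bool
avoids p [] = true
avoids p (s ∷ ss) = not (inH (p ⊕ s)) ∧ avoids (p ⊕ s) ss

endpoint : Point → List Step → Point
endpoint p [] = p
endpoint p (s ∷ ss) = endpoint (p ⊕ s) ss

origin : Point
origin = (+ 0 , + 0)

onSlitPlane : List Step → Bool
onSlitPlane w = avoids origin w

endsAt : List Step → Point → Bool
endsAt w (a , b) with endpoint origin w
... | (x , y) = ⌊ x ℤ.≟ a ⌋ ∧ ⌊ y ℤ.≟ b ⌋

isDiag : Step → Bool
isDiag pp = true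
isDiag mm = true
isDiag pm = false
isDiag mp = false

diagCount : List Step → ℕ
diagCount w = length (filterᵇ isDiag w)

allWalks : ℕ → List (List Step)
allWalks zero = [] ∷ []
allWalks (suc k) = concatMap (λ s → map (s ∷_) (allWalks k)) allSteps

target : Point
target = (+ 2 , + 0)

count : ℕ → ℕ
count n = length (filterᵇ (λ w → onSlitPlane w ∧ endsAt w target) (allWalks (2 * n)))

countDiag : ℕ → ℕ → ℕ
countDiag n j = length (filterᵇ (λ w → onSlitPlane w ∧ endsAt w target ∧ ⌊ diagCount w ℕ.≟ j ⌋) (allWalks (2 * n)))

catalan : ℕ → ℕ
catalan n = ((2 * n) C n) / suc n

module Submission where

-- A walk w of length L = 2n ending at (2,0) has L cyclic rotations, all ending at (2,0). The rotation
-- starting at time j stays off the slit exactly when, at the height of w_j, the point w_j lies strictly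
-- left of every later visit of that height and less than two units right of every earlier one. Since
-- x - y is even along the walk, every height visited by w carries exactly one such time, its last
-- leftmost visit; hence L * #(slit-plane walks) = Σ_h #(walks passing through height h).
-- A diagonal walk is a pair of ±1 paths: its height and its abscissa, or its height and the set of its
-- steps in {(1,1),(-1,-1)}. The height path is a bridge, and by the reflection principle
-- Σ_h #(bridges of length 2n through h) = Σ_h #(paths ending at 2h) = 4^n. The second path contributes
-- C(2n,n+1) = n C_n choices, resp. C(n,m) C(n,m-1) choices of m diagonal up-steps and m-1 diagonal
-- down-steps.

open import Defs

open import Data.Bool using (Bool; true; false; _∧_; _∨_; not)
open import Data.Bool.ListAction using (any)
open import Data.Bool.Properties
  using (∧-assoc; ∧-zeroʳ; ∧-identityʳ; ∨-identityʳ; ∨-zeroʳ; ∧-conicalˡ; ∧-conicalʳ; ¬-not; not-injective; ⇔→≡)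
open import Data.Empty using (⊥-elim)
open import Data.Integer as ℤ using (ℤ; +_; -[1+_])
import Data.Integer.Properties as ℤP
open import Data.Integer.Tactic.RingSolver using (solve-∀)
open import Data.List using (List; []; _∷_; _++_; length; map; concatMap; filterᵇ; take; drop; zipWith; upTo; applyUpTo)
open import Data.List.Membership.Propositional using (_∈_)
open import Data.List.Membership.Propositional.Properties using (∈-upTo⁻; ∈-upTo⁺; ∈-map⁺)
open import Data.List.Properties using (length-upTo; take++drop≡id; take-[]; take-take; take-all; length-take; length-drop)
import Data.List.Relation.Unary.All as All
open import Data.List.Relation.Unary.AllPairs using ([]; _∷_)
open import Data.List.Relation.Unary.Any using (here; there)
open import Data.List.Relation.Unary.Unique.Propositional using (Unique)
open import Data.List.Relation.Unary.Unique.Propositional.Properties using (upTo⁺) renaming (map⁺ to Unique-map⁺)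
open import Data.Nat using (ℕ; _*_; _^_; _≤_; _∸_)
open import Data.Nat as ℕ using (zero; suc; _+_; _<_; z≤n; s≤s)
open import Data.Nat.Combinatorics using (_C_; nCk+nC[k+1]≡[n+1]C[k+1]; nCk≡nC[n∸k]; nC1≡n)
open import Data.Nat.DivMod using (_/_; m*n/n≡m)
open import Data.Nat.Properties as ℕP using (+-assoc; +-comm; +-identityʳ; +-suc; *-comm; *-assoc; *-zeroʳ; *-identityʳ; *-distribˡ-+)
open import Data.Nat.Tactic.RingSolver using () renaming (solve-∀ to ℕ-solve-∀)
open import Algebra.Properties.CommutativeSemigroup ℕP.+-commutativeSemigroup using () renaming (interchange to +-interchange)
open import Data.Product using (_×_; ∃-syntax; _,_; proj₁; proj₂)
open import Data.Sum using (inj₁; inj₂)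
open import Function using (_∘_; id; _$_; _⇔_; mk⇔; Equivalence)
open import Relation.Binary.Definitions using (tri<; tri≈; tri>)
open import Relation.Binary.PropositionalEquality using (_≡_; _≢_; refl; sym; trans; cong; cong₂; subst; subst₂; module ≡-Reasoning)
open import Relation.Nullary using (Dec; yes; no; ¬_)
open import Relation.Nullary.Decidable using (⌊_⌋)

private
  variable
    A B S : Set

𝟙 : Bool → ℕ
𝟙 true = 1
𝟙 false = 0

𝟙-∧ : ∀ a b → 𝟙 (a ∧ b) ≡ 𝟙 a * 𝟙 b
𝟙-∧ true b = sym (+-identityʳ (𝟙 b))
𝟙-∧ false b = refl

⌊⌋-true : ∀ {P : Set} (p? : Dec P) → P → ⌊ p? ⌋ ≡ true
⌊⌋-true (yes _) _ = refl
⌊⌋-true (no ¬p) p = ⊥-elim (¬p p)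

⌊⌋-false : ∀ {P : Set} (p? : Dec P) → ¬ P → ⌊ p? ⌋ ≡ false
⌊⌋-false (yes p) ¬p = ⊥-elim (¬p p)
⌊⌋-false (no _) _ = refl

⌊⌋-true⁻ : ∀ {P : Set} (p? : Dec P) → ⌊ p? ⌋ ≡ true → P
⌊⌋-true⁻ (yes p) _ = p

⌊⌋-⇔ : ∀ {P Q : Set} (p? : Dec P) (q? : Dec Q) → P ⇔ Q → ⌊ p? ⌋ ≡ ⌊ q? ⌋
⌊⌋-⇔ (yes p) q? p⇔q = sym (⌊⌋-true q? (Equivalence.to p⇔q p))
⌊⌋-⇔ (no ¬p) q? p⇔q = sym (⌊⌋-false q? (¬p ∘ Equivalence.from p⇔q))

∧-⇔ : ∀ {a b} {P Q : Set} → a ≡ true ⇔ P → b ≡ true ⇔ Q → a ∧ b ≡ true ⇔ (P × Q)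
∧-⇔ a⇔P b⇔Q = mk⇔ (λ e → Equivalence.to a⇔P (∧-conicalˡ _ _ e) , Equivalence.to b⇔Q (∧-conicalʳ _ _ e))
                  (λ (p , q) → cong₂ _∧_ (Equivalence.from a⇔P p) (Equivalence.from b⇔Q q))

≟-suc : ∀ t a → ⌊ suc t ℕ.≟ suc a ⌋ ≡ ⌊ t ℕ.≟ a ⌋
≟-suc t a = ⌊⌋-⇔ (suc t ℕ.≟ suc a) (t ℕ.≟ a) (mk⇔ ℕP.suc-injective (cong suc))

any-true : (p : A → Bool) {x : A} {xs : List A} → x ∈ xs → p x ≡ true → any p xs ≡ true
any-true p {xs = y ∷ ys} (here refl) px = cong (_∨ any p ys) px
any-true p {xs = y ∷ ys} (there x∈ys) px = trans (cong (p y ∨_) (any-true p x∈ys px)) (∨-zeroʳ (p y))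

any-true⁻ : (p : A → Bool) (xs : List A) → any p xs ≡ true → ∃[ x ] (x ∈ xs × p x ≡ true)
any-true⁻ p (x ∷ xs) e with p x in px
... | true = x , here refl , px
... | false with any-true⁻ p xs e
...   | y , y∈xs , py = y , there y∈xs , py

any-applyUpTo-∘ : (p : ℕ → Bool) (f g : ℕ → ℕ) → ∀ m → any p (applyUpTo (f ∘ g) m) ≡ any (p ∘ f) (applyUpTo g m)
any-applyUpTo-∘ p f g zero = refl
any-applyUpTo-∘ p f g (suc m) = cong (p (f (g 0)) ∨_) (any-applyUpTo-∘ p f (g ∘ suc) m)

-- Sums over lists

∑ : List A → (A → ℕ) → ℕ
∑ [] f = 0
∑ (x ∷ xs) f = f x + ∑ xs f

∑-cong-∈ : (xs : List A) {f g : A → ℕ} → (∀ {x} → x ∈ xs → f x ≡ g x) → ∑ xs f ≡ ∑ xs g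
∑-cong-∈ [] e = refl
∑-cong-∈ (x ∷ xs) e = cong₂ _+_ (e (here refl)) (∑-cong-∈ xs (e ∘ there))

∑-cong : (xs : List A) {f g : A → ℕ} → (∀ x → f x ≡ g x) → ∑ xs f ≡ ∑ xs g
∑-cong xs e = ∑-cong-∈ xs (λ {x} _ → e x)

∑-++ : (xs ys : List A) (f : A → ℕ) → ∑ (xs ++ ys) f ≡ ∑ xs f + ∑ ys f
∑-++ [] ys f = refl
∑-++ (x ∷ xs) ys f = trans (cong (_+_ (f x)) (∑-++ xs ys f)) (sym (+-assoc (f x) _ _))

∑-map : (g : A → B) (xs : List A) (f : B → ℕ) → ∑ (map g xs) f ≡ ∑ xs (f ∘ g)
∑-map g [] f = refl
∑-map g (x ∷ xs) f = cong (_+_ (f (g x))) (∑-map g xs f)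

∑-concatMap : (g : A → List B) (xs : List A) (f : B → ℕ) → ∑ (concatMap g xs) f ≡ ∑ xs (λ x → ∑ (g x) f)
∑-concatMap g [] f = refl
∑-concatMap g (x ∷ xs) f = trans (∑-++ (g x) (concatMap g xs) f) (cong (_+_ (∑ (g x) f)) (∑-concatMap g xs f))

∑-+ : (xs : List A) (f g : A → ℕ) → ∑ xs (λ x → f x + g x) ≡ ∑ xs f + ∑ xs g
∑-+ [] f g = refl
∑-+ (x ∷ xs) f g = trans (cong (_+_ (f x + g x)) (∑-+ xs f g)) (+-interchange (f x) (g x) _ _)

∑-*ˡ : (xs : List A) (c : ℕ) (f : A → ℕ) → ∑ xs (λ x → c * f x) ≡ c * ∑ xs f
∑-*ˡ [] c f = sym (*-zeroʳ c)
∑-*ˡ (x ∷ xs) c f = trans (cong (_+_ (c * f x)) (∑-*ˡ xs c f)) (sym (*-distribˡ-+ c (f x) _))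

∑-*ʳ : (xs : List A) (c : ℕ) (f : A → ℕ) → ∑ xs (λ x → f x * c) ≡ ∑ xs f * c
∑-*ʳ xs c f = trans (∑-cong xs (λ x → *-comm (f x) c)) (trans (∑-*ˡ xs c f) (*-comm c (∑ xs f)))

∑-const : (xs : List A) (c : ℕ) → ∑ xs (λ _ → c) ≡ length xs * c
∑-const [] c = refl
∑-const (x ∷ xs) c = cong (_+_ c) (∑-const xs c)

∑-zero : (xs : List A) {f : A → ℕ} → (∀ x → f x ≡ 0) → ∑ xs f ≡ 0
∑-zero xs f≡0 = trans (∑-cong xs f≡0) (trans (∑-const xs 0) (*-zeroʳ (length xs)))

∑-comm : (xs : List A) (ys : List B) (f : A → B → ℕ) →
         ∑ xs (λ x → ∑ ys (f x)) ≡ ∑ ys (λ y → ∑ xs (λ x → f x y))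
∑-comm [] ys f = sym (trans (∑-const ys 0) (*-zeroʳ (length ys)))
∑-comm (x ∷ xs) ys f =
  trans (cong (_+_ (∑ ys (f x))) (∑-comm xs ys f)) (sym (∑-+ ys (f x) (λ y → ∑ xs (λ x′ → f x′ y))))

∑-𝟙-atMostOne : (p : A → Bool) {xs : List A} → Unique xs →
                (∀ {x y} → x ∈ xs → y ∈ xs → p x ≡ true → p y ≡ true → x ≡ y) →
                ∑ xs (𝟙 ∘ p) ≡ 𝟙 (any p xs)
∑-𝟙-atMostOne p {[]} _ _ = refl
∑-𝟙-atMostOne p {x ∷ xs} (x∉xs ∷ unique) atMostOne with p x in px
... | true = cong suc (trans (∑-cong-∈ xs (cong 𝟙 ∘ p≡false)) (∑-zero xs (λ _ → refl)))
  where
  p≡false : ∀ {y} → y ∈ xs → p y ≡ false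
  p≡false y∈xs = ¬-not (λ py → All.lookup x∉xs y∈xs (sym (atMostOne (there y∈xs) (here refl) py px)))
... | false = ∑-𝟙-atMostOne p unique (λ x∈ y∈ → atMostOne (there x∈) (there y∈))

∑-𝟙-exactlyOne : (p : A → Bool) {xs : List A} {x : A} → Unique xs → x ∈ xs → p x ≡ true →
                 (∀ {y} → y ∈ xs → p y ≡ true → y ≡ x) → ∑ xs (𝟙 ∘ p) ≡ 1
∑-𝟙-exactlyOne p unique x∈xs px onlyX =
  trans (∑-𝟙-atMostOne p unique (λ y∈ z∈ py pz → trans (onlyX y∈ py) (sym (onlyX z∈ pz))))
        (cong 𝟙 (any-true p x∈xs px))

-- Words over an alphabet

rotate : ℕ → List A → List A
rotate j w = drop j w ++ take j w

drop-length-++ : (u v : List A) → drop (length u) (u ++ v) ≡ v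
drop-length-++ [] v = refl
drop-length-++ (a ∷ u) v = drop-length-++ u v

take-length-++ : (u v : List A) → take (length u) (u ++ v) ≡ u
take-length-++ [] v = refl
take-length-++ (a ∷ u) v = cong (a ∷_) (take-length-++ u v)

rotate-++ : (u v : List A) → rotate (length u) (u ++ v) ≡ v ++ u
rotate-++ u v = cong₂ _++_ (drop-length-++ u v) (take-length-++ u v)

words : List A → ℕ → List (List A)
words as zero = [] ∷ []
words as (suc k) = concatMap (λ a → map (a ∷_) (words as k)) as

module _ (as : List A) where

  ∑-words-suc : ∀ k (F : List A → ℕ) → ∑ (words as (suc k)) F ≡ ∑ as (λ a → ∑ (words as k) (F ∘ (a ∷_)))
  ∑-words-suc k F = trans (∑-concatMap _ as F) (∑-cong as (λ a → ∑-map (a ∷_) (words as k) F))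

  ∑-words-cong : ∀ k {F G : List A → ℕ} → (∀ w → length w ≡ k → F w ≡ G w) →
                 ∑ (words as k) F ≡ ∑ (words as k) G
  ∑-words-cong zero e = cong (_+ 0) (e [] refl)
  ∑-words-cong (suc k) {F} {G} e = begin
    ∑ (words as (suc k)) F                    ≡⟨ ∑-words-suc k F ⟩
    ∑ as (λ a → ∑ (words as k) (F ∘ (a ∷_)))  ≡⟨ ∑-cong as (λ a → ∑-words-cong k (λ w ∣w∣ → e (a ∷ w) (cong suc ∣w∣))) ⟩
    ∑ as (λ a → ∑ (words as k) (G ∘ (a ∷_)))  ≡⟨ ∑-words-suc k G ⟨
    ∑ (words as (suc k)) G                    ∎
    where open ≡-Reasoning

  ∑-words-count : ∀ k → ∑ (words as k) (λ _ → 1) ≡ length as ^ k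
  ∑-words-count zero = refl
  ∑-words-count (suc k) =
    trans (∑-words-suc k _) (trans (∑-cong as (λ _ → ∑-words-count k)) (∑-const as (length as ^ k)))

  ∑-words-++ : ∀ j k (F : List A → ℕ) →
               ∑ (words as (j + k)) F ≡ ∑ (words as j) (λ u → ∑ (words as k) (λ v → F (u ++ v)))
  ∑-words-++ zero k F = sym (+-identityʳ _)
  ∑-words-++ (suc j) k F = begin
    ∑ (words as (suc j + k)) F
      ≡⟨ ∑-words-suc (j + k) F ⟩
    ∑ as (λ a → ∑ (words as (j + k)) (F ∘ (a ∷_)))
      ≡⟨ ∑-cong as (λ a → ∑-words-++ j k (F ∘ (a ∷_))) ⟩
    ∑ as (λ a → ∑ (words as j) (λ u → ∑ (words as k) (λ v → F (a ∷ u ++ v))))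
      ≡⟨ ∑-words-suc j _ ⟨
    ∑ (words as (suc j)) (λ u → ∑ (words as k) (λ v → F (u ++ v)))
      ∎
    where open ≡-Reasoning

  ∑-words-map : (σ : A → A) → (∀ (G : A → ℕ) → ∑ as (G ∘ σ) ≡ ∑ as G) →
                ∀ k (F : List A → ℕ) → ∑ (words as k) (F ∘ map σ) ≡ ∑ (words as k) F
  ∑-words-map σ σ-bij zero F = refl
  ∑-words-map σ σ-bij (suc k) F = begin
    ∑ (words as (suc k)) (F ∘ map σ)                    ≡⟨ ∑-words-suc k _ ⟩
    ∑ as (λ a → ∑ (words as k) (λ u → F (σ a ∷ map σ u))) ≡⟨ ∑-cong as (λ a → ∑-words-map σ σ-bij k (F ∘ (σ a ∷_))) ⟩
    ∑ as (λ a → ∑ (words as k) (F ∘ (σ a ∷_)))           ≡⟨ σ-bij (λ a → ∑ (words as k) (F ∘ (a ∷_))) ⟩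
    ∑ as (λ a → ∑ (words as k) (F ∘ (a ∷_)))             ≡⟨ ∑-words-suc k F ⟨
    ∑ (words as (suc k)) F                              ∎
    where open ≡-Reasoning

  ∑-words-rotate : ∀ {L} j → j ≤ L → (F : List A → ℕ) → ∑ (words as L) (F ∘ rotate j) ≡ ∑ (words as L) F
  ∑-words-rotate j j≤L F with k , refl ← ℕP.m≤n⇒∃[o]m+o≡n j≤L = begin
    ∑ (words as (j + k)) (F ∘ rotate j)
      ≡⟨ ∑-words-++ j k _ ⟩
    ∑ (words as j) (λ u → ∑ (words as k) (λ v → F (rotate j (u ++ v))))
      ≡⟨ ∑-words-cong j (λ u ∣u∣≡j → ∑-cong (words as k) (λ v → cong (λ i → F (rotate i (u ++ v))) (sym ∣u∣≡j))) ⟩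
    ∑ (words as j) (λ u → ∑ (words as k) (λ v → F (rotate (length u) (u ++ v))))
      ≡⟨ ∑-cong (words as j) (λ u → ∑-cong (words as k) (λ v → cong F (rotate-++ u v))) ⟩
    ∑ (words as j) (λ u → ∑ (words as k) (λ v → F (v ++ u)))
      ≡⟨ ∑-comm (words as j) (words as k) _ ⟩
    ∑ (words as k) (λ v → ∑ (words as j) (λ u → F (v ++ u)))
      ≡⟨ ∑-words-++ k j F ⟨
    ∑ (words as (k + j)) F
      ≡⟨ cong (λ i → ∑ (words as i) F) (+-comm k j) ⟩
    ∑ (words as (j + k)) F
      ∎
    where open ≡-Reasoning

  ∑-words-allRotations : ∀ L (F : List A → ℕ) →
                         ∑ (words as L) (λ w → ∑ (upTo L) (λ j → F (rotate j w))) ≡ L * ∑ (words as L) F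
  ∑-words-allRotations L F = begin
    ∑ (words as L) (λ w → ∑ (upTo L) (λ j → F (rotate j w)))
      ≡⟨ ∑-comm (words as L) (upTo L) _ ⟩
    ∑ (upTo L) (λ j → ∑ (words as L) (F ∘ rotate j))
      ≡⟨ ∑-cong-∈ (upTo L) (λ j∈ → ∑-words-rotate _ (ℕP.<⇒≤ (∈-upTo⁻ j∈)) F) ⟩
    ∑ (upTo L) (λ _ → ∑ (words as L) F)
      ≡⟨ ∑-const (upTo L) _ ⟩
    length (upTo L) * ∑ (words as L) F
      ≡⟨ cong (_* ∑ (words as L) F) (length-upTo L) ⟩
    L * ∑ (words as L) F
      ∎
    where open ≡-Reasoning

module _ {as : List A} {bs : List B} {ss : List S} (f : A → B → S)
         (f-bij : ∀ (G : S → ℕ) → ∑ ss G ≡ ∑ as (λ a → ∑ bs (λ b → G (f a b)))) where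

  ∑-words-zipWith : ∀ k (F : List S → ℕ) →
                    ∑ (words ss k) F ≡ ∑ (words as k) (λ u → ∑ (words bs k) (λ v → F (zipWith f u v)))
  ∑-words-zipWith zero F = sym (+-identityʳ _)
  ∑-words-zipWith (suc k) F = begin
    ∑ (words ss (suc k)) F
      ≡⟨ ∑-words-suc ss k F ⟩
    ∑ ss (λ s → ∑ (words ss k) (F ∘ (s ∷_)))
      ≡⟨ ∑-cong ss (λ s → ∑-words-zipWith k (F ∘ (s ∷_))) ⟩
    ∑ ss (λ s → ∑ (words as k) (λ u → ∑ (words bs k) (λ v → F (s ∷ zipWith f u v))))
      ≡⟨ f-bij _ ⟩
    ∑ as (λ a → ∑ bs (λ b → ∑ (words as k) (λ u → ∑ (words bs k) (λ v → F (f a b ∷ zipWith f u v)))))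
      ≡⟨ ∑-cong as (λ a → ∑-comm bs (words as k) _) ⟩
    ∑ as (λ a → ∑ (words as k) (λ u → ∑ bs (λ b → ∑ (words bs k) (λ v → F (zipWith f (a ∷ u) (b ∷ v))))))
      ≡⟨ ∑-cong as (λ a → ∑-cong (words as k) (λ u → ∑-words-suc bs k _)) ⟨
    ∑ as (λ a → ∑ (words as k) (λ u → ∑ (words bs (suc k)) (λ v → F (zipWith f (a ∷ u) v))))
      ≡⟨ ∑-words-suc as k _ ⟨
    ∑ (words as (suc k)) (λ u → ∑ (words bs (suc k)) (λ v → F (zipWith f u v)))
      ∎
    where open ≡-Reasoning

allWalks≡words : ∀ k → allWalks k ≡ words allSteps k
allWalks≡words zero = refl
allWalks≡words (suc k) = cong (λ ws → concatMap (λ s → map (s ∷_) ws) allSteps) (allWalks≡words k)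

length-filterᵇ : ∀ (p : A → Bool) xs → length (filterᵇ p xs) ≡ ∑ xs (𝟙 ∘ p)
length-filterᵇ p [] = refl
length-filterᵇ p (x ∷ xs) with p x
... | true = cong suc (length-filterᵇ p xs)
... | false = length-filterᵇ p xs

2*n≡n+n : ∀ n → 2 * n ≡ n + n
2*n≡n+n n = cong (_+_ n) (+-identityʳ n)

2*[1+m]∸1≡1+2m : ∀ m → 2 * suc m ∸ 1 ≡ suc (m + m)
2*[1+m]∸1≡1+2m m = trans (+-suc m (m + 0)) (cong (λ k → suc (m + k)) (+-identityʳ m))

2^[n+n]≡4^n : ∀ n → 2 ^ (n + n) ≡ 4 ^ n
2^[n+n]≡4^n n = sym (trans (ℕP.^-*-assoc 2 2 n) (cong (2 ^_) (2*n≡n+n n)))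

count-allWalks : ∀ n (p : List Step → Bool) → length (filterᵇ p (allWalks (2 * n))) ≡ ∑ (words allSteps (n + n)) (𝟙 ∘ p)
count-allWalks n p = trans (length-filterᵇ p (allWalks (2 * n)))
  (cong (λ ws → ∑ ws (𝟙 ∘ p)) (trans (allWalks≡words (2 * n)) (cong (words allSteps) (2*n≡n+n n))))

-- Integer arithmetic

ℤ-+-cancelˡ : ∀ a {b c} → a ℤ.+ b ≡ a ℤ.+ c → b ≡ c
ℤ-+-cancelˡ a {b} {c} e = trans (sym (-a+[a+x]≡x a b)) (trans (cong (ℤ._+_ (ℤ.- a)) e) (-a+[a+x]≡x a c))
  where
  -a+[a+x]≡x : ∀ a x → ℤ.- a ℤ.+ (a ℤ.+ x) ≡ x
  -a+[a+x]≡x = solve-∀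

ℤ-+-cancelʳ : ∀ c {a b} → a ℤ.+ c ≡ b ℤ.+ c → a ≡ b
ℤ-+-cancelʳ c {a} {b} e = ℤ-+-cancelˡ c (trans (ℤP.+-comm c a) (trans e (ℤP.+-comm b c)))

ℤ-double-injective : ∀ {a b} → a ℤ.+ a ≡ b ℤ.+ b → a ≡ b
ℤ-double-injective {a} {b} e with ℤP.<-cmp a b
... | tri< a<b _ _ = ⊥-elim (ℤP.<-irrefl e (ℤP.+-mono-< a<b a<b))
... | tri≈ _ a≡b _ = a≡b
... | tri> _ _ b<a = ⊥-elim (ℤP.<-irrefl (sym e) (ℤP.+-mono-< b<a b<a))

SameParity : ℤ → ℤ → Set
SameParity x y = ∃[ t ] (x ≡ y ℤ.+ (t ℤ.+ t))

odd≢even : ∀ t → t ℤ.+ t ≢ + 1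
odd≢even (+ zero) ()
odd≢even (+ suc n) e = ℕP.0≢1+n (sym (ℕP.suc-injective (trans (sym (+-suc (suc n) n)) (ℤP.+-injective e))))
odd≢even -[1+ n ] ()

sameParity⇒≢1+ : ∀ {a c y} → SameParity a y → SameParity c y → c ≢ + 1 ℤ.+ a
sameParity⇒≢1+ {a} {c} {y} (s , refl) (t , refl) c≡1+a = odd≢even (t ℤ.- s) (begin
  (t ℤ.- s) ℤ.+ (t ℤ.- s)                             ≡⟨ difference y s t ⟩
  y ℤ.+ (t ℤ.+ t) ℤ.- (y ℤ.+ (s ℤ.+ s))                ≡⟨ cong (ℤ._- (y ℤ.+ (s ℤ.+ s))) c≡1+a ⟩
  + 1 ℤ.+ (y ℤ.+ (s ℤ.+ s)) ℤ.- (y ℤ.+ (s ℤ.+ s))      ≡⟨ one y s ⟩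
  + 1                                                 ∎)
  where
  open ≡-Reasoning
  difference : ∀ y s t → (t ℤ.- s) ℤ.+ (t ℤ.- s) ≡ y ℤ.+ (t ℤ.+ t) ℤ.- (y ℤ.+ (s ℤ.+ s))
  difference = solve-∀
  one : ∀ y s → + 1 ℤ.+ (y ℤ.+ (s ℤ.+ s)) ℤ.- (y ℤ.+ (s ℤ.+ s)) ≡ + 1
  one = solve-∀

between⇒1+ : ∀ {a c} → a ℤ.< c → c ℤ.< + 2 ℤ.+ a → c ≡ + 1 ℤ.+ a
between⇒1+ {a} {c} a<c c<2+a = ℤP.≤-antisym c≤1+a (ℤP.i<j⇒suc[i]≤j a<c)
  where
  c≤1+a : c ℤ.≤ + 1 ℤ.+ a
  c≤1+a = subst₂ ℤ._≤_ (-1+[1+x]≡x c) (-1+[2+x]≡1+x a) (ℤP.+-monoʳ-≤ (ℤ.- + 1) (ℤP.i<j⇒suc[i]≤j c<2+a))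
    where
    -1+[1+x]≡x : ∀ x → ℤ.- + 1 ℤ.+ (+ 1 ℤ.+ x) ≡ x
    -1+[1+x]≡x = solve-∀
    -1+[2+x]≡1+x : ∀ x → ℤ.- + 1 ℤ.+ (+ 2 ℤ.+ x) ≡ + 1 ℤ.+ x
    -1+[2+x]≡1+x = solve-∀

x<2+x : ∀ x → x ℤ.< + 2 ℤ.+ x
x<2+x x = subst₂ ℤ._<_ (ℤP.+-identityˡ x) refl (ℤP.+-monoˡ-< x {+ 0} {+ 2} (ℤ.+<+ (s≤s z≤n)))

symmetricRange : ℕ → List ℤ
symmetricRange L = map (λ i → + i ℤ.- + L) (upTo (suc (L + L)))

symmetricRange-unique : ∀ L → Unique (symmetricRange L)
symmetricRange-unique L = Unique-map⁺ (ℤP.+-injective ∘ ℤ-+-cancelʳ (ℤ.- + L)) (upTo⁺ (suc (L + L)))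

∈-symmetricRange : ∀ {L h} → ℤ.∣ h ∣ ≤ L → h ∈ symmetricRange L
∈-symmetricRange {L} {+ k} k≤L =
  subst (_∈ symmetricRange L) (trans (cong (ℤ._- + L) (ℤP.pos-+ k L)) (x+L-L≡x (+ k) (+ L)))
        (∈-map⁺ _ (∈-upTo⁺ (s≤s (ℕP.+-monoˡ-≤ L k≤L))))
  where
  x+L-L≡x : ∀ x L → x ℤ.+ L ℤ.- L ≡ x
  x+L-L≡x = solve-∀
∈-symmetricRange {L} { -[1+ k ]} 1+k≤L =
  subst (_∈ symmetricRange L) (trans (cong (ℤ._- + L) L∸[1+k]) (L-a-L≡-a (+ L) (+ suc k)))
        (∈-map⁺ _ (∈-upTo⁺ (s≤s (ℕP.≤-trans (ℕP.m∸n≤m L (suc k)) (ℕP.m≤m+n L L)))))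
  where
  L-a-L≡-a : ∀ L a → L ℤ.- a ℤ.- L ≡ ℤ.- a
  L-a-L≡-a = solve-∀
  L∸[1+k] : + (L ∸ suc k) ≡ + L ℤ.- + suc k
  L∸[1+k] = sym (trans (ℤP.[+m]-[+n]≡m⊖n L (suc k)) (ℤP.⊖-≥ 1+k≤L))

-- Cut points of a closed sequence of positions

LastMinimiser : (P : ℕ → Set) (f : ℕ → ℤ) (N j : ℕ) → Set
LastMinimiser P f N j = j < N × P j × (∀ k → k < j → P k → f j ℤ.≤ f k)
                                     × (∀ k → j < k → k < N → P k → f j ℤ.< f k)

lastMinimiser : ∀ {P : ℕ → Set} → (∀ k → Dec (P k)) → (f : ℕ → ℤ) →
                ∀ N → ∃[ j ] (j < N × P j) → ∃[ j ] LastMinimiser P f N j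
lastMinimiser P? f (suc N) (j₀ , j₀<1+N , Pj₀) with ℕP.anyUpTo? P? N | P? N
... | no none | no ¬PN with ℕP.m<1+n⇒m<n∨m≡n j₀<1+N
...   | inj₁ j₀<N = ⊥-elim (none (j₀ , j₀<N , Pj₀))
...   | inj₂ refl = ⊥-elim (¬PN Pj₀)
lastMinimiser P? f (suc N) _ | no none | yes PN =
  N , ℕP.≤-refl , PN , (λ k k<N Pk → ⊥-elim (none (k , k<N , Pk)))
    , (λ k N<k k<1+N _ → ⊥-elim (ℕP.<⇒≱ N<k (ℕP.≤-pred k<1+N)))
lastMinimiser P? f (suc N) _ | yes some | no ¬PN with lastMinimiser P? f N some
... | j , j<N , Pj , left , right = j , ℕP.m<n⇒m<1+n j<N , Pj , left , right′
  where
  right′ : ∀ k → j < k → k < suc N → _ → f j ℤ.< f k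
  right′ k j<k k<1+N Pk with ℕP.m<1+n⇒m<n∨m≡n k<1+N
  ... | inj₁ k<N = right k j<k k<N Pk
  ... | inj₂ refl = ⊥-elim (¬PN Pk)
lastMinimiser P? f (suc N) _ | yes some | yes PN with lastMinimiser P? f N some
... | j , j<N , Pj , left , right with f N ℤ.≤? f j
...   | yes fN≤fj = N , ℕP.≤-refl , PN , left′ , (λ k N<k k<1+N _ → ⊥-elim (ℕP.<⇒≱ N<k (ℕP.≤-pred k<1+N)))
  where
  left′ : ∀ k → k < N → _ → f N ℤ.≤ f k
  left′ k k<N Pk with ℕP.<-cmp k j
  ... | tri< k<j _ _ = ℤP.≤-trans fN≤fj (left k k<j Pk)
  ... | tri≈ _ refl _ = fN≤fj
  ... | tri> _ _ j<k = ℤP.≤-trans fN≤fj (ℤP.<⇒≤ (right k j<k k<N Pk))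
...   | no fN≰fj = j , ℕP.m<n⇒m<1+n j<N , Pj , left , right′
  where
  right′ : ∀ k → j < k → k < suc N → _ → f j ℤ.< f k
  right′ k j<k k<1+N Pk with ℕP.m<1+n⇒m<n∨m≡n k<1+N
  ... | inj₁ k<N = right k j<k k<N Pk
  ... | inj₂ refl = ℤP.≰⇒> fN≰fj

-- X, Y are the coordinates of w_0, ..., w_L with w_L = w_0 + (2,0). The rotation of the walk starting at
-- time j visits w_k - w_j for j < k ≤ L and then w_k + (2,0) - w_j for 0 < k ≤ j; Cut j says that none
-- of these points lies on the slit.
module CutPoints (L : ℕ) (X Y : ℕ → ℤ) where

  ClearAhead : ℕ → Set
  ClearAhead j = ∀ k → j < k → k ≤ L → Y k ≡ Y j → X j ℤ.< X k

  ClearBehind : ℕ → Set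
  ClearBehind j = ∀ k → 0 < k → k ≤ j → Y k ≡ Y j → X j ℤ.< + 2 ℤ.+ X k

  Cut : ℕ → Set
  Cut j = ClearAhead j × ClearBehind j

  visits : ℤ → Bool
  visits h = any (λ k → ⌊ Y k ℤ.≟ h ⌋) (upTo (suc L))

  module _ (XL : X L ≡ + 2 ℤ.+ X 0) (YL : Y L ≡ Y 0) (parity : ∀ k → SameParity (X k) (Y k)) where

    0<L : 0 < L
    0<L = ℕP.n≢0⇒n>0 (λ { refl → ℤP.<-irrefl XL (x<2+x (X 0)) })

    -- Two cuts at one height would have abscissas exactly 1 apart, which parity forbids.
    cut-injective-height : ∀ {j₁ j₂} → j₁ < j₂ → j₂ < L → Cut j₁ → Cut j₂ → Y j₁ ≢ Y j₂
    cut-injective-height {j₁} {j₂} j₁<j₂ j₂<L (ahead₁ , _) (ahead₂ , behind₂) Yj₁≡Yj₂ =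
      sameParity⇒≢1+ {y = Y j₁} (parity j₁) (subst (SameParity (X j₂)) (sym Yj₁≡Yj₂) (parity j₂))
                     (between⇒1+ (ahead₁ j₂ j₁<j₂ (ℕP.<⇒≤ j₂<L) (sym Yj₁≡Yj₂)) (X₂<2+X j₁ j₁<j₂ Yj₁≡Yj₂))
      where
      X₂<2+X : ∀ i → i < j₂ → Y i ≡ Y j₂ → X j₂ ℤ.< + 2 ℤ.+ X i
      X₂<2+X zero _ Y0≡Yj₂ = subst (X j₂ ℤ.<_) XL (ahead₂ L j₂<L ℕP.≤-refl (trans YL Y0≡Yj₂))
      X₂<2+X (suc i) i<j₂ Yi≡Yj₂ = behind₂ (suc i) (s≤s z≤n) (ℕP.<⇒≤ i<j₂) Yi≡Yj₂

    -- The cut at height h is the last visit of h with minimal abscissa.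
    lastMinimiser⇒cut : ∀ {h j} → LastMinimiser (λ k → Y k ≡ h) X L j → Cut j
    lastMinimiser⇒cut {h} {j} (j<L , Yj≡h , left , right) = ahead , behind
      where
      ahead : ClearAhead j
      ahead k j<k k≤L Yk≡Yj with ℕP.m≤n⇒m<n∨m≡n k≤L
      ... | inj₁ k<L = right k j<k k<L (trans Yk≡Yj Yj≡h)
      ... | inj₂ refl = subst (X j ℤ.<_) (sym XL) (Xj<2+X0 j refl)
        where
        Xj<2+X0 : ∀ i → i ≡ j → X i ℤ.< + 2 ℤ.+ X 0
        Xj<2+X0 zero refl = x<2+x (X 0)
        Xj<2+X0 (suc i) refl = ℤP.≤-<-trans (left 0 (s≤s z≤n) (trans (sym YL) (trans Yk≡Yj Yj≡h))) (x<2+x (X 0))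
      behind : ClearBehind j
      behind k 0<k k≤j Yk≡Yj with ℕP.m≤n⇒m<n∨m≡n k≤j
      ... | inj₁ k<j = ℤP.≤-<-trans (left k k<j (trans Yk≡Yj Yj≡h)) (x<2+x (X k))
      ... | inj₂ refl = x<2+x (X j)

    cutsAtSameHeight : ∀ {j₁ j₂} → j₁ < L → j₂ < L → Cut j₁ → Cut j₂ → Y j₁ ≡ Y j₂ → j₁ ≡ j₂
    cutsAtSameHeight {j₁} {j₂} j₁<L j₂<L cut₁ cut₂ Yj₁≡Yj₂ with ℕP.<-cmp j₁ j₂
    ... | tri< j₁<j₂ _ _ = ⊥-elim (cut-injective-height j₁<j₂ j₂<L cut₁ cut₂ Yj₁≡Yj₂)
    ... | tri≈ _ j₁≡j₂ _ = j₁≡j₂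
    ... | tri> _ _ j₂<j₁ = ⊥-elim (cut-injective-height j₂<j₁ j₁<L cut₂ cut₁ (sym Yj₁≡Yj₂))

    visitBeforeL : ∀ {h} k → k < suc L → Y k ≡ h → ∃[ j ] (j < L × Y j ≡ h)
    visitBeforeL k k<1+L Yk≡h with ℕP.m<1+n⇒m<n∨m≡n k<1+L
    ... | inj₁ k<L = k , k<L , Yk≡h
    ... | inj₂ refl = 0 , 0<L , trans (sym YL) Yk≡h

    visits⇒cut : ∀ h → visits h ≡ true → ∃[ j ] (j < L × Cut j × Y j ≡ h)
    visits⇒cut h e with k , k∈ , Yk≟h ← any-true⁻ _ (upTo (suc L)) e
                   with j , min ← lastMinimiser (λ k → Y k ℤ.≟ h) X L
                                    (visitBeforeL k (∈-upTo⁻ k∈) (⌊⌋-true⁻ (Y k ℤ.≟ h) Yk≟h))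
      = j , proj₁ min , lastMinimiser⇒cut min , proj₁ (proj₂ min)

    module _ (cut? : ℕ → Bool) (cut?⇔ : ∀ j → j < L → cut? j ≡ true ⇔ Cut j) where

      cutsAtHeight : ∀ h → ∑ (upTo L) (λ j → 𝟙 (cut? j ∧ ⌊ Y j ℤ.≟ h ⌋)) ≡ 𝟙 (visits h)
      cutsAtHeight h = trans (∑-𝟙-atMostOne cutAt (upTo⁺ L) atMostOne) (cong 𝟙 (⇔→≡ (mk⇔ cut⇒visit visit⇒cut)))
        where
        cutAt : ℕ → Bool
        cutAt j = cut? j ∧ ⌊ Y j ℤ.≟ h ⌋
        cutAt⇒ : ∀ {j} → j ∈ upTo L → cutAt j ≡ true → Cut j × Y j ≡ h
        cutAt⇒ {j} j∈ e =
          Equivalence.to (cut?⇔ j (∈-upTo⁻ j∈)) (∧-conicalˡ _ _ e) , ⌊⌋-true⁻ (Y j ℤ.≟ h) (∧-conicalʳ _ _ e)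
        atMostOne : ∀ {j₁ j₂} → j₁ ∈ upTo L → j₂ ∈ upTo L → cutAt j₁ ≡ true → cutAt j₂ ≡ true → j₁ ≡ j₂
        atMostOne j₁∈ j₂∈ e₁ e₂ with cut₁ , Yj₁≡h ← cutAt⇒ j₁∈ e₁ | cut₂ , Yj₂≡h ← cutAt⇒ j₂∈ e₂ =
          cutsAtSameHeight (∈-upTo⁻ j₁∈) (∈-upTo⁻ j₂∈) cut₁ cut₂ (trans Yj₁≡h (sym Yj₂≡h))
        cut⇒visit : any cutAt (upTo L) ≡ true → visits h ≡ true
        cut⇒visit e with j , j∈ , cutAtj ← any-true⁻ cutAt (upTo L) e =
          any-true _ (∈-upTo⁺ (ℕP.m<n⇒m<1+n (∈-upTo⁻ j∈))) (⌊⌋-true (Y j ℤ.≟ h) (proj₂ (cutAt⇒ j∈ cutAtj)))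
        visit⇒cut : visits h ≡ true → any cutAt (upTo L) ≡ true
        visit⇒cut e with j , j<L , cut , Yj≡h ← visits⇒cut h e =
          any-true cutAt (∈-upTo⁺ j<L) (cong₂ _∧_ (Equivalence.from (cut?⇔ j j<L) cut) (⌊⌋-true (Y j ℤ.≟ h) Yj≡h))

      cuts≡visitedHeights : (Hs : List ℤ) → Unique Hs → (∀ j → j < L → Y j ∈ Hs) →
                            ∑ (upTo L) (𝟙 ∘ cut?) ≡ ∑ Hs (𝟙 ∘ visits)
      cuts≡visitedHeights Hs unique Y∈Hs = begin
        ∑ (upTo L) (𝟙 ∘ cut?)
          ≡⟨ ∑-cong-∈ (upTo L) (λ j∈ → splitByHeight _ (∈-upTo⁻ j∈)) ⟩
        ∑ (upTo L) (λ j → ∑ Hs (λ h → 𝟙 (cut? j ∧ ⌊ Y j ℤ.≟ h ⌋)))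
          ≡⟨ ∑-comm (upTo L) Hs _ ⟩
        ∑ Hs (λ h → ∑ (upTo L) (λ j → 𝟙 (cut? j ∧ ⌊ Y j ℤ.≟ h ⌋)))
          ≡⟨ ∑-cong Hs cutsAtHeight ⟩
        ∑ Hs (𝟙 ∘ visits)
          ∎
        where
        open ≡-Reasoning
        splitByHeight : ∀ j → j < L → 𝟙 (cut? j) ≡ ∑ Hs (λ h → 𝟙 (cut? j ∧ ⌊ Y j ℤ.≟ h ⌋))
        splitByHeight j j<L = sym (begin
          ∑ Hs (λ h → 𝟙 (cut? j ∧ ⌊ Y j ℤ.≟ h ⌋))  ≡⟨ ∑-cong Hs (λ h → 𝟙-∧ (cut? j) _) ⟩
          ∑ Hs (λ h → 𝟙 (cut? j) * 𝟙 ⌊ Y j ℤ.≟ h ⌋) ≡⟨ ∑-*ˡ Hs (𝟙 (cut? j)) _ ⟩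
          𝟙 (cut? j) * ∑ Hs (λ h → 𝟙 ⌊ Y j ℤ.≟ h ⌋) ≡⟨ cong (𝟙 (cut? j) *_) onlyOwnHeight ⟩
          𝟙 (cut? j) * 1                           ≡⟨ *-identityʳ _ ⟩
          𝟙 (cut? j)                               ∎)
          where
          onlyOwnHeight : ∑ Hs (λ h → 𝟙 ⌊ Y j ℤ.≟ h ⌋) ≡ 1
          onlyOwnHeight = ∑-𝟙-exactlyOne _ unique (Y∈Hs j j<L) (⌊⌋-true (Y j ℤ.≟ Y j) refl)
                            (λ {h} _ e → sym (⌊⌋-true⁻ (Y j ℤ.≟ h) e))

-- Diagonal walks and their rotations

infixl 6 _⊞_
_⊞_ : Point → Point → Point
(a , b) ⊞ (c , d) = (a ℤ.+ c , b ℤ.+ d)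

⊞-assoc : ∀ p q r → (p ⊞ q) ⊞ r ≡ p ⊞ (q ⊞ r)
⊞-assoc (a , b) (c , d) (e , f) = cong₂ _,_ (ℤP.+-assoc a c e) (ℤP.+-assoc b d f)

⊞-comm : ∀ p q → p ⊞ q ≡ q ⊞ p
⊞-comm (a , b) (c , d) = cong₂ _,_ (ℤP.+-comm a c) (ℤP.+-comm b d)

⊞-identityˡ : ∀ p → origin ⊞ p ≡ p
⊞-identityˡ (a , b) = cong₂ _,_ (ℤP.+-identityˡ a) (ℤP.+-identityˡ b)

⊞-identityʳ : ∀ p → p ⊞ origin ≡ p
⊞-identityʳ p = trans (⊞-comm p origin) (⊞-identityˡ p)

⊕≡⊞vec : ∀ p s → p ⊕ s ≡ p ⊞ vec s
⊕≡⊞vec p pp = refl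
⊕≡⊞vec p pm = refl
⊕≡⊞vec p mp = refl
⊕≡⊞vec p mm = refl

E : List Step → Point
E = endpoint origin

endpoint≡⊞E : ∀ p w → endpoint p w ≡ p ⊞ E w
endpoint≡⊞E p [] = sym (⊞-identityʳ p)
endpoint≡⊞E p (s ∷ w) = begin
  endpoint (p ⊕ s) w         ≡⟨ endpoint≡⊞E (p ⊕ s) w ⟩
  p ⊕ s ⊞ E w                ≡⟨ cong (_⊞ E w) (⊕≡⊞vec p s) ⟩
  p ⊞ vec s ⊞ E w            ≡⟨ ⊞-assoc p (vec s) (E w) ⟩
  p ⊞ (vec s ⊞ E w)          ≡⟨ cong (λ q → p ⊞ (q ⊞ E w)) (trans (⊕≡⊞vec origin s) (⊞-identityˡ (vec s))) ⟨
  p ⊞ (origin ⊕ s ⊞ E w)     ≡⟨ cong (p ⊞_) (endpoint≡⊞E (origin ⊕ s) w) ⟨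
  p ⊞ E (s ∷ w)              ∎
  where open ≡-Reasoning

E-∷ : ∀ s w → E (s ∷ w) ≡ vec s ⊞ E w
E-∷ s w = trans (endpoint≡⊞E (origin ⊕ s) w) (cong (_⊞ E w) (trans (⊕≡⊞vec origin s) (⊞-identityˡ (vec s))))

endpoint-++ : ∀ p u v → endpoint p (u ++ v) ≡ endpoint (endpoint p u) v
endpoint-++ p [] v = refl
endpoint-++ p (s ∷ u) v = endpoint-++ (p ⊕ s) u v

E-++ : ∀ u v → E (u ++ v) ≡ E u ⊞ E v
E-++ u v = trans (endpoint-++ origin u v) (endpoint≡⊞E (E u) v)

E-rotate : ∀ j w → E (rotate j w) ≡ E w
E-rotate j w = begin
  E (drop j w ++ take j w)   ≡⟨ E-++ (drop j w) (take j w) ⟩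
  E (drop j w) ⊞ E (take j w) ≡⟨ ⊞-comm (E (drop j w)) (E (take j w)) ⟩
  E (take j w) ⊞ E (drop j w) ≡⟨ E-++ (take j w) (drop j w) ⟨
  E (take j w ++ drop j w)   ≡⟨ cong E (take++drop≡id j w) ⟩
  E w                        ∎
  where open ≡-Reasoning

diagCount-++ : ∀ u v → diagCount (u ++ v) ≡ diagCount u + diagCount v
diagCount-++ [] v = refl
diagCount-++ (s ∷ u) v with isDiag s
... | true = cong suc (diagCount-++ u v)
... | false = diagCount-++ u v

diagCount-rotate : ∀ j w → diagCount (rotate j w) ≡ diagCount w
diagCount-rotate j w = begin
  diagCount (drop j w ++ take j w)           ≡⟨ diagCount-++ (drop j w) (take j w) ⟩
  diagCount (drop j w) + diagCount (take j w) ≡⟨ +-comm (diagCount (drop j w)) _ ⟩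
  diagCount (take j w) + diagCount (drop j w) ≡⟨ diagCount-++ (take j w) (drop j w) ⟨
  diagCount (take j w ++ drop j w)           ≡⟨ cong diagCount (take++drop≡id j w) ⟩
  diagCount w                                ∎
  where open ≡-Reasoning

endsAt-E : ∀ w {x y a b} → E w ≡ (x , y) → endsAt w (a , b) ≡ ⌊ x ℤ.≟ a ⌋ ∧ ⌊ y ℤ.≟ b ⌋
endsAt-E w e rewrite e = refl

endsAt-rotate : ∀ j w t → endsAt (rotate j w) t ≡ endsAt w t
endsAt-rotate j w (a , b) = trans (endsAt-E (rotate j w) (E-rotate j w)) (sym (endsAt-E w refl))

endsAt⇒E : ∀ w {a b} → endsAt w (a , b) ≡ true → E w ≡ (a , b)
endsAt⇒E w e with x≟a ← ∧-conicalˡ _ _ (trans (sym (endsAt-E w refl)) e)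
                | y≟b ← ∧-conicalʳ _ _ (trans (sym (endsAt-E w refl)) e)
  = cong₂ _,_ (⌊⌋-true⁻ (_ ℤ.≟ _) x≟a) (⌊⌋-true⁻ (_ ℤ.≟ _) y≟b)

offSlit⇔ : ∀ u q {v} → u ⊞ q ≡ v → inH q ≡ false ⇔ (proj₂ v ≡ proj₂ u → proj₁ u ℤ.< proj₁ v)
offSlit⇔ (u₁ , u₂) (q₁ , q₂) refl with q₂ ℤ.≟ + 0 | q₁ ℤ.≤? + 0
... | yes refl | yes q₁≤0 = mk⇔ (λ ()) (λ ahead → ⊥-elim (ℤP.<⇒≱ (ahead (ℤP.+-identityʳ u₂)) u₁+q₁≤u₁))
  where
  u₁+q₁≤u₁ : u₁ ℤ.+ q₁ ℤ.≤ u₁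
  u₁+q₁≤u₁ = subst (u₁ ℤ.+ q₁ ℤ.≤_) (ℤP.+-identityʳ u₁) (ℤP.+-monoʳ-≤ u₁ q₁≤0)
... | yes refl | no q₁≰0 = mk⇔ (λ _ _ → u₁<u₁+q₁) (λ _ → refl)
  where
  u₁<u₁+q₁ : u₁ ℤ.< u₁ ℤ.+ q₁
  u₁<u₁+q₁ = subst (ℤ._< u₁ ℤ.+ q₁) (ℤP.+-identityʳ u₁) (ℤP.+-monoʳ-< u₁ (ℤP.≰⇒> q₁≰0))
... | no q₂≢0 | _ = mk⇔ (λ _ e → ⊥-elim (q₂≢0 (ℤ-+-cancelˡ u₂ (trans e (sym (ℤP.+-identityʳ u₂)))))) (λ _ → refl)

avoids⇔ : ∀ p w → avoids p w ≡ true ⇔ (∀ k → k < length w → inH (endpoint p (take (suc k) w)) ≡ false)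
avoids⇔ p [] = mk⇔ (λ _ _ ()) (λ _ → refl)
avoids⇔ p (s ∷ w) = mk⇔ to from
  where
  to : avoids p (s ∷ w) ≡ true → ∀ k → k < suc (length w) → inH (endpoint p (take (suc k) (s ∷ w))) ≡ false
  to e zero _ = not-injective (∧-conicalˡ _ _ e)
  to e (suc k) (s≤s k<∣w∣) = Equivalence.to (avoids⇔ (p ⊕ s) w) (∧-conicalʳ _ _ e) k k<∣w∣
  from : (∀ k → k < suc (length w) → inH (endpoint p (take (suc k) (s ∷ w))) ≡ false) → avoids p (s ∷ w) ≡ true
  from off = cong₂ _∧_ (cong not (off 0 (s≤s z≤n)))
                       (Equivalence.from (avoids⇔ (p ⊕ s) w) (λ k k<∣w∣ → off (suc k) (s≤s k<∣w∣)))

avoids-++ : ∀ p u v → avoids p (u ++ v) ≡ avoids p u ∧ avoids (endpoint p u) v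
avoids-++ p [] v = refl
avoids-++ p (s ∷ u) v = trans (cong (not (inH (p ⊕ s)) ∧_) (avoids-++ (p ⊕ s) u v)) (sym (∧-assoc (not (inH (p ⊕ s))) _ _))

take-+ : ∀ j k (w : List A) → take (j + k) w ≡ take j w ++ take k (drop j w)
take-+ zero k w = refl
take-+ (suc j) k [] = sym (take-[] k)
take-+ (suc j) k (a ∷ w) = cong (a ∷_) (take-+ j k w)

pos : List Step → ℕ → Point
pos w k = E (take k w)

module _ (w : List Step) (Ew : E w ≡ target) {j : ℕ} (j≤L : j ≤ length w) where
  open CutPoints (length w) (proj₁ ∘ pos w) (proj₂ ∘ pos w)

  private
    L = length w
    X = proj₁ ∘ pos w
    Y = proj₂ ∘ pos w

    pos-ahead : ∀ s → pos w j ⊞ E (take (suc s) (drop j w)) ≡ pos w (j + suc s)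
    pos-ahead s = sym (trans (cong E (take-+ j (suc s) w)) (E-++ (take j w) _))

    pos-behind : ∀ k → k ≤ j → pos w j ⊞ endpoint (E (drop j w)) (take k (take j w)) ≡ (+ 2 ℤ.+ X k , Y k)
    pos-behind k k≤j = begin
      pos w j ⊞ endpoint (E (drop j w)) (take k (take j w))
        ≡⟨ cong (pos w j ⊞_) (endpoint≡⊞E (E (drop j w)) (take k (take j w))) ⟩
      pos w j ⊞ (E (drop j w) ⊞ E (take k (take j w)))
        ≡⟨ cong (λ u → pos w j ⊞ (E (drop j w) ⊞ E u))
                (trans (take-take k j w) (cong (λ i → take i w) (ℕP.m≤n⇒m⊓n≡m k≤j))) ⟩
      pos w j ⊞ (E (drop j w) ⊞ pos w k)
        ≡⟨ ⊞-assoc (pos w j) _ _ ⟨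
      E (take j w) ⊞ E (drop j w) ⊞ pos w k
        ≡⟨ cong (_⊞ pos w k) (trans (sym (E-++ (take j w) (drop j w))) (trans (cong E (take++drop≡id j w)) Ew)) ⟩
      target ⊞ pos w k
        ≡⟨ cong (+ 2 ℤ.+ X k ,_) (ℤP.+-identityˡ (Y k)) ⟩
      (+ 2 ℤ.+ X k , Y k)
        ∎
      where open ≡-Reasoning

    s<L∸j⇔ : ∀ s → s < L ∸ j ⇔ j + suc s ≤ L
    s<L∸j⇔ s = mk⇔ (λ lt → subst (_≤ L) (+-comm (suc s) j) (ℕP.m≤o∸n⇒m+n≤o (suc s) j≤L lt))
                   (λ le → ℕP.m+n≤o⇒m≤o∸n (suc s) (subst (_≤ L) (+-comm j (suc s)) le))

    ahead⇔ : avoids origin (drop j w) ≡ true ⇔ ClearAhead j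
    ahead⇔ = mk⇔ to from
      where
      avoidsDrop⇔ = avoids⇔ origin (drop j w)
      ∣drop∣ : length (drop j w) ≡ L ∸ j
      ∣drop∣ = length-drop j w
      to : avoids origin (drop j w) ≡ true → ClearAhead j
      to e k j<k k≤L Yk≡Yj with s , refl ← ℕP.m≤n⇒∃[o]m+o≡n j<k =
        subst (λ i → X j ℤ.< X i) (+-suc j s)
          (Equivalence.to (offSlit⇔ (pos w j) _ (pos-ahead s))
            (Equivalence.to avoidsDrop⇔ e s
              (subst (s <_) (sym ∣drop∣) (Equivalence.from (s<L∸j⇔ s) (subst (_≤ L) (sym (+-suc j s)) k≤L))))
            (trans (cong Y (+-suc j s)) Yk≡Yj))
      from : ClearAhead j → avoids origin (drop j w) ≡ true
      from ahead = Equivalence.from avoidsDrop⇔ λ s s<∣drop∣ →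
        Equivalence.from (offSlit⇔ (pos w j) _ (pos-ahead s))
          (ahead (j + suc s) (ℕP.m<m+n j (s≤s z≤n)) (Equivalence.to (s<L∸j⇔ s) (subst (s <_) ∣drop∣ s<∣drop∣)))

    behind⇔ : avoids (E (drop j w)) (take j w) ≡ true ⇔ ClearBehind j
    behind⇔ = mk⇔ to from
      where
      avoidsTake⇔ = avoids⇔ (E (drop j w)) (take j w)
      ∣take∣ : length (take j w) ≡ j
      ∣take∣ = trans (length-take j w) (ℕP.m≤n⇒m⊓n≡m j≤L)
      to : avoids (E (drop j w)) (take j w) ≡ true → ClearBehind j
      to e zero () _ _
      to e (suc s) _ 1+s≤j Yk≡Yj =
        Equivalence.to (offSlit⇔ (pos w j) _ (pos-behind (suc s) 1+s≤j))
          (Equivalence.to avoidsTake⇔ e s (subst (s <_) (sym ∣take∣) 1+s≤j)) Yk≡Yj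
      from : ClearBehind j → avoids (E (drop j w)) (take j w) ≡ true
      from behind = Equivalence.from avoidsTake⇔ λ s s<∣take∣ →
        let 1+s≤j = subst (s <_) ∣take∣ s<∣take∣ in
        Equivalence.from (offSlit⇔ (pos w j) _ (pos-behind (suc s) 1+s≤j)) (behind (suc s) (s≤s z≤n) 1+s≤j)

  rotate-onSlitPlane⇔cut : onSlitPlane (rotate j w) ≡ true ⇔ Cut j
  rotate-onSlitPlane⇔cut = subst (λ b → b ≡ true ⇔ Cut j) (sym (avoids-++ origin (drop j w) (take j w))) (∧-⇔ ahead⇔ behind⇔)

sameParity-+ : ∀ {a b c d} → SameParity a b → SameParity c d → SameParity (a ℤ.+ c) (b ℤ.+ d)
sameParity-+ {b = b} {d = d} (s , a≡) (t , c≡) = s ℤ.+ t , trans (cong₂ ℤ._+_ a≡ c≡) (regroup b s d t)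
  where
  regroup : ∀ b s d t → b ℤ.+ (s ℤ.+ s) ℤ.+ (d ℤ.+ (t ℤ.+ t)) ≡ b ℤ.+ d ℤ.+ ((s ℤ.+ t) ℤ.+ (s ℤ.+ t))
  regroup = solve-∀

sameParity-vec : ∀ s → SameParity (proj₁ (vec s)) (proj₂ (vec s))
sameParity-vec pp = + 0 , refl
sameParity-vec pm = + 1 , refl
sameParity-vec mp = -[1+ 0 ] , refl
sameParity-vec mm = + 0 , refl

sameParity-E : ∀ w → SameParity (proj₁ (E w)) (proj₂ (E w))
sameParity-E [] = + 0 , refl
sameParity-E (s ∷ w) =
  subst (λ p → SameParity (proj₁ p) (proj₂ p)) (sym (E-∷ s w))
        (sameParity-+ {b = proj₂ (vec s)} {d = proj₂ (E w)} (sameParity-vec s) (sameParity-E w))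

∣height∣≤length : ∀ w → ℤ.∣ proj₂ (E w) ∣ ≤ length w
∣height∣≤length [] = z≤n
∣height∣≤length (s ∷ w) = subst (λ p → ℤ.∣ proj₂ p ∣ ≤ suc (length w)) (sym (E-∷ s w))
  (ℕP.≤-trans (ℤP.∣i+j∣≤∣i∣+∣j∣ (proj₂ (vec s)) _)
              (subst (_≤ suc (length w)) (cong (_+ _) (sym (∣vec₂∣≡1 s))) (s≤s (∣height∣≤length w))))
  where
  ∣vec₂∣≡1 : ∀ s → ℤ.∣ proj₂ (vec s) ∣ ≡ 1
  ∣vec₂∣≡1 pp = refl
  ∣vec₂∣≡1 pm = refl
  ∣vec₂∣≡1 mp = refl
  ∣vec₂∣≡1 mm = refl

visitsHeight : ℤ → List Step → Bool
visitsHeight h w = any (λ k → ⌊ proj₂ (pos w k) ℤ.≟ h ⌋) (upTo (suc (length w)))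

slitRotations≡visitedHeights : ∀ w → E w ≡ target →
  ∑ (upTo (length w)) (λ j → 𝟙 (onSlitPlane (rotate j w))) ≡ ∑ (symmetricRange (length w)) (λ h → 𝟙 (visitsHeight h w))
slitRotations≡visitedHeights w Ew =
  cuts≡visitedHeights (cong proj₁ posL≡target) (cong proj₂ posL≡target) (λ k → sameParity-E (take k w))
    (λ j → onSlitPlane (rotate j w)) (λ j j<L → rotate-onSlitPlane⇔cut w Ew (ℕP.<⇒≤ j<L))
    (symmetricRange (length w)) (symmetricRange-unique (length w))
    (λ j _ → ∈-symmetricRange (ℕP.≤-trans (∣height∣≤length (take j w))
                                          (subst (_≤ length w) (sym (length-take j w)) (ℕP.m⊓n≤n j (length w)))))
  where
  open CutPoints (length w) (proj₁ ∘ pos w) (proj₂ ∘ pos w)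
  posL≡target : pos w (length w) ≡ target
  posL≡target = trans (cong E (take-all (length w) w ℕP.≤-refl)) Ew

module _ (Q : List Step → Bool) (Q-rotate : ∀ j w → Q (rotate j w) ≡ Q w) (Q⇒target : ∀ w → Q w ≡ true → E w ≡ target) where

  private
    perWalk : ∀ w → ∑ (upTo (length w)) (λ j → 𝟙 (onSlitPlane (rotate j w) ∧ Q (rotate j w)))
                  ≡ ∑ (symmetricRange (length w)) (λ h → 𝟙 (Q w ∧ visitsHeight h w))
    perWalk w with Q w in Qw
    ... | false = trans (∑-zero (upTo (length w)) (λ j → cong 𝟙 (trans (cong (_ ∧_) (trans (Q-rotate j w) Qw)) (∧-zeroʳ _))))
                        (sym (∑-zero (symmetricRange (length w)) (λ _ → refl)))
    ... | true = trans (∑-cong (upTo (length w)) (λ j → cong 𝟙 (trans (cong (_ ∧_) (trans (Q-rotate j w) Qw)) (∧-identityʳ _))))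
                       (slitRotations≡visitedHeights w (Q⇒target w Qw))

  slitCount≡visitedHeights : ∀ L → L * ∑ (words allSteps L) (λ w → 𝟙 (onSlitPlane w ∧ Q w))
                                   ≡ ∑ (symmetricRange L) (λ h → ∑ (words allSteps L) (λ w → 𝟙 (Q w ∧ visitsHeight h w)))
  slitCount≡visitedHeights L = begin
    L * ∑ (words allSteps L) (λ w → 𝟙 (onSlitPlane w ∧ Q w))
      ≡⟨ ∑-words-allRotations allSteps L _ ⟨
    ∑ (words allSteps L) (λ w → ∑ (upTo L) (λ j → 𝟙 (onSlitPlane (rotate j w) ∧ Q (rotate j w))))
      ≡⟨ ∑-words-cong allSteps L (λ w ∣w∣≡L →
           subst (λ L′ → ∑ (upTo L′) _ ≡ ∑ (symmetricRange L′) _) ∣w∣≡L (perWalk w)) ⟩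
    ∑ (words allSteps L) (λ w → ∑ (symmetricRange L) (λ h → 𝟙 (Q w ∧ visitsHeight h w)))
      ≡⟨ ∑-comm (words allSteps L) (symmetricRange L) _ ⟩
    ∑ (symmetricRange L) (λ h → ∑ (words allSteps L) (λ w → 𝟙 (Q w ∧ visitsHeight h w)))
      ∎
    where open ≡-Reasoning

-- ±1 paths and the reflection principle

bools : List Bool
bools = true ∷ false ∷ []

sgn : Bool → ℤ
sgn true = + 1
sgn false = -[1+ 0 ]

drift : List Bool → ℤ
drift [] = + 0
drift (b ∷ bs) = sgn b ℤ.+ drift bs

trues : List Bool → ℕ
trues bs = ∑ bs 𝟙

falses : List Bool → ℕ
falses bs = ∑ bs (𝟙 ∘ not)

trues+falses≡length : ∀ bs → trues bs + falses bs ≡ length bs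
trues+falses≡length [] = refl
trues+falses≡length (true ∷ bs) = cong suc (trues+falses≡length bs)
trues+falses≡length (false ∷ bs) = trans (+-suc (trues bs) (falses bs)) (cong suc (trues+falses≡length bs))

drift+length≡2trues : ∀ bs → drift bs ℤ.+ + length bs ≡ + trues bs ℤ.+ + trues bs
drift+length≡2trues [] = refl
drift+length≡2trues (true ∷ bs) = begin
  + 1 ℤ.+ drift bs ℤ.+ (+ 1 ℤ.+ + length bs)   ≡⟨ regroup (drift bs) (+ length bs) ⟩
  + 2 ℤ.+ (drift bs ℤ.+ + length bs)           ≡⟨ cong (ℤ._+_ (+ 2)) (drift+length≡2trues bs) ⟩
  + 2 ℤ.+ (+ trues bs ℤ.+ + trues bs)          ≡⟨ regroup′ (+ trues bs) ⟩
  + 1 ℤ.+ + trues bs ℤ.+ (+ 1 ℤ.+ + trues bs)  ∎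
  where
  open ≡-Reasoning
  regroup : ∀ d l → + 1 ℤ.+ d ℤ.+ (+ 1 ℤ.+ l) ≡ + 2 ℤ.+ (d ℤ.+ l)
  regroup = solve-∀
  regroup′ : ∀ t → + 2 ℤ.+ (t ℤ.+ t) ≡ + 1 ℤ.+ t ℤ.+ (+ 1 ℤ.+ t)
  regroup′ = solve-∀
drift+length≡2trues (false ∷ bs) = trans (regroup (drift bs) (+ length bs)) (drift+length≡2trues bs)
  where
  regroup : ∀ d l → ℤ.- + 1 ℤ.+ d ℤ.+ (+ 1 ℤ.+ l) ≡ d ℤ.+ l
  regroup = solve-∀

drift≡double : ∀ {n} bs → length bs ≡ n + n → drift bs ≡ (+ trues bs ℤ.- + n) ℤ.+ (+ trues bs ℤ.- + n)
drift≡double {n} bs ∣bs∣≡2n = begin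
  drift bs                                               ≡⟨ cancel (drift bs) (+ n) ⟨
  drift bs ℤ.+ (+ n ℤ.+ + n) ℤ.- (+ n ℤ.+ + n)
    ≡⟨ cong (λ l → drift bs ℤ.+ l ℤ.- (+ n ℤ.+ + n)) (trans (sym (ℤP.pos-+ n n)) (cong +_ (sym ∣bs∣≡2n))) ⟩
  drift bs ℤ.+ + length bs ℤ.- (+ n ℤ.+ + n)             ≡⟨ cong (ℤ._- (+ n ℤ.+ + n)) (drift+length≡2trues bs) ⟩
  + trues bs ℤ.+ + trues bs ℤ.- (+ n ℤ.+ + n)            ≡⟨ regroup (+ trues bs) (+ n) ⟩
  (+ trues bs ℤ.- + n) ℤ.+ (+ trues bs ℤ.- + n)          ∎
  where
  open ≡-Reasoning
  cancel : ∀ d n → d ℤ.+ (n ℤ.+ n) ℤ.- (n ℤ.+ n) ≡ d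
  cancel = solve-∀
  regroup : ∀ t n → t ℤ.+ t ℤ.- (n ℤ.+ n) ≡ (t ℤ.- n) ℤ.+ (t ℤ.- n)
  regroup = solve-∀

drift≡double⇔ : ∀ {n k} bs → length bs ≡ n + n → drift bs ≡ (+ k ℤ.- + n) ℤ.+ (+ k ℤ.- + n) ⇔ trues bs ≡ k
drift≡double⇔ {n} {k} bs ∣bs∣≡2n = mk⇔
  (λ e → ℤP.+-injective (ℤ-+-cancelʳ (ℤ.- + n) (ℤ-double-injective (trans (sym (drift≡double {n} bs ∣bs∣≡2n)) e))))
  (λ { refl → drift≡double {n} bs ∣bs∣≡2n })

passesThrough : ℤ → ℤ → List Bool → Bool
passesThrough y h [] = ⌊ y ℤ.≟ h ⌋
passesThrough y h (b ∷ bs) = ⌊ y ℤ.≟ h ⌋ ∨ passesThrough (y ℤ.+ sgn b) h bs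

endingAt : ℕ → ℤ → ℤ → ℕ
endingAt k y t = ∑ (words bools k) (λ bs → 𝟙 ⌊ y ℤ.+ drift bs ℤ.≟ t ⌋)

endingAtVia : ℕ → ℤ → ℤ → ℤ → ℕ
endingAtVia k y h t = ∑ (words bools k) (λ bs → 𝟙 (⌊ y ℤ.+ drift bs ℤ.≟ t ⌋ ∧ passesThrough y h bs))

∑-map-not : ∀ k (F : List Bool → ℕ) → ∑ (words bools k) (F ∘ map not) ≡ ∑ (words bools k) F
∑-map-not = ∑-words-map bools not not-swaps
  where
  not-swaps : ∀ G → G false + (G true + 0) ≡ G true + (G false + 0)
  not-swaps G = trans (cong (_+_ (G false)) (+-identityʳ (G true)))
                      (trans (+-comm (G false) (G true)) (cong (_+_ (G true)) (sym (+-identityʳ (G false)))))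

sgn-not : ∀ b → sgn (not b) ≡ ℤ.- sgn b
sgn-not true = refl
sgn-not false = refl

drift-map-not : ∀ bs → drift (map not bs) ≡ ℤ.- drift bs
drift-map-not [] = refl
drift-map-not (b ∷ bs) = trans (cong₂ ℤ._+_ (sgn-not b) (drift-map-not bs)) (sym (ℤP.neg-distrib-+ (sgn b) (drift bs)))

≟-neg : ∀ a b → ⌊ ℤ.- a ℤ.≟ ℤ.- b ⌋ ≡ ⌊ a ℤ.≟ b ⌋
≟-neg a b = ⌊⌋-⇔ (ℤ.- a ℤ.≟ ℤ.- b) (a ℤ.≟ b) (mk⇔ ℤP.neg-injective (cong (λ z → ℤ.- z)))

passesThrough-map-not : ∀ y h bs → passesThrough (ℤ.- y) (ℤ.- h) (map not bs) ≡ passesThrough y h bs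
passesThrough-map-not y h [] = ≟-neg y h
passesThrough-map-not y h (b ∷ bs) = cong₂ _∨_ (≟-neg y h)
  (trans (cong (λ z → passesThrough z (ℤ.- h) (map not bs))
               (trans (cong (ℤ._+_ (ℤ.- y)) (sgn-not b)) (sym (ℤP.neg-distrib-+ y (sgn b)))))
         (passesThrough-map-not (y ℤ.+ sgn b) h bs))

passesThrough-start : ∀ y bs → passesThrough y y bs ≡ true
passesThrough-start y [] = ⌊⌋-true (y ℤ.≟ y) refl
passesThrough-start y (b ∷ bs) = cong (_∨ passesThrough (y ℤ.+ sgn b) y bs) (⌊⌋-true (y ℤ.≟ y) refl)

end-map-not : ∀ y t bs → ⌊ ℤ.- y ℤ.+ drift (map not bs) ℤ.≟ ℤ.- t ⌋ ≡ ⌊ y ℤ.+ drift bs ℤ.≟ t ⌋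
end-map-not y t bs =
  trans (cong (λ z → ⌊ z ℤ.≟ ℤ.- t ⌋) (trans (cong (ℤ._+_ (ℤ.- y)) (drift-map-not bs)) (sym (ℤP.neg-distrib-+ y (drift bs)))))
                           (≟-neg (y ℤ.+ drift bs) t)

endingAt-neg : ∀ k y t → endingAt k y t ≡ endingAt k (ℤ.- y) (ℤ.- t)
endingAt-neg k y t = trans (∑-cong (words bools k) (λ bs → cong 𝟙 (sym (end-map-not y t bs)))) (∑-map-not k _)

endingAtVia-neg : ∀ k y h t → endingAtVia k y h t ≡ endingAtVia k (ℤ.- y) (ℤ.- h) (ℤ.- t)
endingAtVia-neg k y h t =
  trans (∑-cong (words bools k) (λ bs → cong 𝟙 (sym (cong₂ _∧_ (end-map-not y t bs) (passesThrough-map-not y h bs)))))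
        (∑-map-not k _)

endingAt-mirror : ∀ k y t → endingAt k y t ≡ endingAt k y ((y ℤ.+ y) ℤ.- t)
endingAt-mirror k y t = trans (∑-cong (words bools k) mirrored) (∑-map-not k _)
  where
  y+d≡t⇔ : ∀ d → y ℤ.+ d ≡ t ⇔ y ℤ.+ ℤ.- d ≡ (y ℤ.+ y) ℤ.- t
  y+d≡t⇔ d = mk⇔ (λ e → trans (reflect y d) (cong (ℤ._-_ (y ℤ.+ y)) e))
                 (λ e → trans (sym (reflect-back y d)) (trans (cong (ℤ._-_ (y ℤ.+ y)) e) (cancel (y ℤ.+ y) t)))
    where
    reflect : ∀ y d → y ℤ.+ ℤ.- d ≡ (y ℤ.+ y) ℤ.- (y ℤ.+ d)
    reflect = solve-∀
    reflect-back : ∀ y d → (y ℤ.+ y) ℤ.- (y ℤ.+ ℤ.- d) ≡ y ℤ.+ d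
    reflect-back = solve-∀
    cancel : ∀ a t → a ℤ.- (a ℤ.- t) ≡ t
    cancel = solve-∀
  mirrored : ∀ bs → 𝟙 ⌊ y ℤ.+ drift bs ℤ.≟ t ⌋ ≡ 𝟙 ⌊ y ℤ.+ drift (map not bs) ℤ.≟ (y ℤ.+ y) ℤ.- t ⌋
  mirrored bs = cong 𝟙 (trans (⌊⌋-⇔ (_ ℤ.≟ t) (_ ℤ.≟ _) (y+d≡t⇔ (drift bs)))
                              (cong (λ d → ⌊ y ℤ.+ d ℤ.≟ (y ℤ.+ y) ℤ.- t ⌋) (sym (drift-map-not bs))))

endingAt-suc : ∀ k y t → endingAt (suc k) y t ≡ ∑ bools (λ b → endingAt k (y ℤ.+ sgn b) t)
endingAt-suc k y t = trans (∑-words-suc bools k _)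
  (∑-cong bools (λ b → ∑-cong (words bools k) (λ bs → cong (λ z → 𝟙 ⌊ z ℤ.≟ t ⌋) (sym (ℤP.+-assoc y (sgn b) (drift bs))))))

endingAtVia-suc : ∀ k {y h} t → y ≢ h → endingAtVia (suc k) y h t ≡ ∑ bools (λ b → endingAtVia k (y ℤ.+ sgn b) h t)
endingAtVia-suc k {y} {h} t y≢h = trans (∑-words-suc bools k _)
  (∑-cong bools (λ b → ∑-cong (words bools k) (λ bs →
    cong₂ (λ z v → 𝟙 (⌊ z ℤ.≟ t ⌋ ∧ v)) (sym (ℤP.+-assoc y (sgn b) (drift bs)))
          (cong (_∨ passesThrough (y ℤ.+ sgn b) h bs) (⌊⌋-false (y ℤ.≟ h) y≢h)))))

reflection : ∀ k {y h t} → y ℤ.≤ h → t ℤ.≤ h → endingAtVia k y h t ≡ endingAt k y ((h ℤ.+ h) ℤ.- t)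
reflection k {y} {h} {t} y≤h t≤h with y ℤ.≟ h
... | yes refl =
  trans (∑-cong (words bools k) (λ bs → cong 𝟙 (trans (cong (⌊ y ℤ.+ drift bs ℤ.≟ t ⌋ ∧_) (passesThrough-start y bs)) (∧-identityʳ _))))
                       (endingAt-mirror k y t)
reflection zero {y} {h} {t} y≤h t≤h | no y≢h =
  trans (cong (λ b → 𝟙 b + 0) (trans (cong (_ ∧_) (⌊⌋-false (y ℤ.≟ h) y≢h)) (∧-zeroʳ _)))
        (sym (cong (λ b → 𝟙 b + 0) (⌊⌋-false (_ ℤ.≟ _) y≢2h-t)))
  where
  h≤2h-t : h ℤ.≤ (h ℤ.+ h) ℤ.- t
  h≤2h-t = subst (ℤ._≤ (h ℤ.+ h) ℤ.- t) (h+h-h≡h h) (ℤP.+-monoʳ-≤ (h ℤ.+ h) (ℤP.neg-mono-≤ t≤h))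
    where
    h+h-h≡h : ∀ h → (h ℤ.+ h) ℤ.- h ≡ h
    h+h-h≡h = solve-∀
  y≢2h-t : y ℤ.+ + 0 ≢ (h ℤ.+ h) ℤ.- t
  y≢2h-t e = ℤP.<⇒≱ (ℤP.≤∧≢⇒< y≤h y≢h) (subst (h ℤ.≤_) (trans (sym e) (ℤP.+-identityʳ y)) h≤2h-t)
reflection (suc k) {y} {h} {t} y≤h t≤h | no y≢h =
  trans (endingAtVia-suc k t y≢h) (trans (∑-cong bools (λ b → reflection k (step≤h b) t≤h)) (sym (endingAt-suc k y _)))
  where
  step≤h : ∀ b → y ℤ.+ sgn b ℤ.≤ h
  step≤h true = subst (ℤ._≤ h) (ℤP.+-comm (+ 1) y) (ℤP.i<j⇒suc[i]≤j (ℤP.≤∧≢⇒< y≤h y≢h))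
  step≤h false = ℤP.i≤j⇒i-k≤j (+ 1) y≤h

bridgesVia≡endingAt : ∀ k h → endingAtVia k (+ 0) h (+ 0) ≡ endingAt k (+ 0) (h ℤ.+ h)
bridgesVia≡endingAt k h with + 0 ℤ.≤? h
... | yes 0≤h = trans (reflection k 0≤h 0≤h) (cong (endingAt k (+ 0)) (ℤP.+-identityʳ (h ℤ.+ h)))
... | no 0≰h = begin
  endingAtVia k (+ 0) h (+ 0)                           ≡⟨ endingAtVia-neg k (+ 0) h (+ 0) ⟩
  endingAtVia k (+ 0) (ℤ.- h) (+ 0)                     ≡⟨ reflection k 0≤-h 0≤-h ⟩
  endingAt k (+ 0) ((ℤ.- h ℤ.+ ℤ.- h) ℤ.- + 0)          ≡⟨ cong (endingAt k (+ 0)) (-h-h≡-[h+h] h) ⟩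
  endingAt k (+ 0) (ℤ.- (h ℤ.+ h))                      ≡⟨ endingAt-neg k (+ 0) (ℤ.- (h ℤ.+ h)) ⟩
  endingAt k (+ 0) (ℤ.- ℤ.- (h ℤ.+ h))                  ≡⟨ cong (endingAt k (+ 0)) (ℤP.neg-involutive (h ℤ.+ h)) ⟩
  endingAt k (+ 0) (h ℤ.+ h)                            ∎
  where
  open ≡-Reasoning
  0≤-h : + 0 ℤ.≤ ℤ.- h
  0≤-h = ℤP.neg-mono-≤ (ℤP.<⇒≤ (ℤP.≰⇒> 0≰h))
  -h-h≡-[h+h] : ∀ h → (ℤ.- h ℤ.+ ℤ.- h) ℤ.- + 0 ≡ ℤ.- (h ℤ.+ h)
  -h-h≡-[h+h] = solve-∀

-- A path of length 2n ends at height 2h for exactly one h with |h| ≤ 2n.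
∑-bridgesVia : ∀ n → ∑ (symmetricRange (n + n)) (λ h → endingAtVia (n + n) (+ 0) h (+ 0)) ≡ 2 ^ (n + n)
∑-bridgesVia n = begin
  ∑ (symmetricRange L) (λ h → endingAtVia L (+ 0) h (+ 0))
    ≡⟨ ∑-cong (symmetricRange L) (bridgesVia≡endingAt L) ⟩
  ∑ (symmetricRange L) (λ h → ∑ (words bools L) (λ bs → 𝟙 ⌊ + 0 ℤ.+ drift bs ℤ.≟ h ℤ.+ h ⌋))
    ≡⟨ ∑-comm (symmetricRange L) (words bools L) _ ⟩
  ∑ (words bools L) (λ bs → ∑ (symmetricRange L) (λ h → 𝟙 ⌊ + 0 ℤ.+ drift bs ℤ.≟ h ℤ.+ h ⌋))
    ≡⟨ ∑-words-cong bools L halfDrift ⟩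
  ∑ (words bools L) (λ _ → 1)
    ≡⟨ ∑-words-count bools L ⟩
  2 ^ L
    ∎
  where
  open ≡-Reasoning
  L = n + n
  halfDrift : ∀ bs → length bs ≡ L → ∑ (symmetricRange L) (λ h → 𝟙 ⌊ + 0 ℤ.+ drift bs ℤ.≟ h ℤ.+ h ⌋) ≡ 1
  halfDrift bs ∣bs∣≡L =
    ∑-𝟙-exactlyOne _ (symmetricRange-unique L) (∈-symmetricRange {h = δ} ∣δ∣≤L) (⌊⌋-true (_ ℤ.≟ _) drift≡δ+δ)
                          (λ {h} _ e → ℤ-double-injective (trans (sym (⌊⌋-true⁻ (_ ℤ.≟ h ℤ.+ h) e)) drift≡δ+δ))
    where
    δ = + trues bs ℤ.- + n
    drift≡δ+δ : + 0 ℤ.+ drift bs ≡ δ ℤ.+ δ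
    drift≡δ+δ = trans (ℤP.+-identityˡ (drift bs)) (drift≡double {n} bs ∣bs∣≡L)
    trues≤L : trues bs ≤ L
    trues≤L = subst (trues bs ≤_) (trans (trues+falses≡length bs) ∣bs∣≡L) (ℕP.m≤m+n (trues bs) (falses bs))
    ∣δ∣≤L : ℤ.∣ δ ∣ ≤ L
    ∣δ∣≤L = subst (λ z → ℤ.∣ z ∣ ≤ L) (sym (ℤP.[+m]-[+n]≡m⊖n (trues bs) n))
              (ℕP.≤-trans (ℤP.∣m⊝n∣≤m⊔n (trues bs) n) (ℕP.⊔-lub trues≤L (ℕP.m≤m+n n n)))

isBridge : List Bool → Bool
isBridge ys = ⌊ drift ys ℤ.≟ + 0 ⌋

-- Counting marked positions

∑-trues≟ : ∀ k a → ∑ (words bools k) (λ xs → 𝟙 ⌊ trues xs ℕ.≟ a ⌋) ≡ k C a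
∑-trues≟ zero zero = refl
∑-trues≟ zero (suc a) = refl
∑-trues≟ (suc k) zero = trans (∑-words-suc bools k _) $
  cong₂ _+_ (∑-zero (words bools k) (λ _ → refl)) (trans (+-identityʳ _) (∑-trues≟ k zero))
∑-trues≟ (suc k) (suc a) = trans (∑-words-suc bools k _) $ begin
  ∑ (words bools k) (λ xs → 𝟙 ⌊ suc (trues xs) ℕ.≟ suc a ⌋) + (∑ (words bools k) (λ xs → 𝟙 ⌊ trues xs ℕ.≟ suc a ⌋) + 0)
    ≡⟨ cong₂ _+_ (trans (∑-cong (words bools k) (λ xs → cong 𝟙 (≟-suc (trues xs) a))) (∑-trues≟ k a))
                 (trans (+-identityʳ _) (∑-trues≟ k (suc a))) ⟩
  k C a + k C suc a
    ≡⟨ nCk+nC[k+1]≡[n+1]C[k+1] k a ⟩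
  suc k C suc a
    ∎
  where open ≡-Reasoning

markedUps markedDowns : List Bool → List Bool → ℕ
markedUps ys ds = trues (zipWith _∧_ ys ds)
markedDowns ys ds = trues (zipWith (λ y d → not y ∧ d) ys ds)

∑-marked≟ : ∀ ys a b → ∑ (words bools (length ys)) (λ ds → 𝟙 (⌊ markedUps ys ds ℕ.≟ a ⌋ ∧ ⌊ markedDowns ys ds ℕ.≟ b ⌋))
                        ≡ (trues ys C a) * (falses ys C b)
∑-marked≟ [] zero zero = refl
∑-marked≟ [] zero (suc b) = refl
∑-marked≟ [] (suc a) b = refl
∑-marked≟ (true ∷ ys) zero b = trans (∑-words-suc bools (length ys) _) $
  cong₂ _+_ (∑-zero (words bools (length ys)) (λ _ → refl)) (trans (+-identityʳ _) (∑-marked≟ ys zero b))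
∑-marked≟ (true ∷ ys) (suc a) b = trans (∑-words-suc bools (length ys) _) $ begin
  ∑ (words bools (length ys)) (λ ds → 𝟙 (⌊ suc (markedUps ys ds) ℕ.≟ suc a ⌋ ∧ ⌊ markedDowns ys ds ℕ.≟ b ⌋))
    + (∑ (words bools (length ys)) (λ ds → 𝟙 (⌊ markedUps ys ds ℕ.≟ suc a ⌋ ∧ ⌊ markedDowns ys ds ℕ.≟ b ⌋)) + 0)
    ≡⟨ cong₂ _+_ (trans (∑-cong (words bools (length ys)) (λ ds → cong (λ c → 𝟙 (c ∧ _)) (≟-suc (markedUps ys ds) a)))
                        (∑-marked≟ ys a b))
                 (trans (+-identityʳ _) (∑-marked≟ ys (suc a) b)) ⟩
  (trues ys C a) * (falses ys C b) + (trues ys C suc a) * (falses ys C b)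
    ≡⟨ ℕP.*-distribʳ-+ (falses ys C b) (trues ys C a) _ ⟨
  (trues ys C a + trues ys C suc a) * (falses ys C b)
    ≡⟨ cong (_* (falses ys C b)) (nCk+nC[k+1]≡[n+1]C[k+1] (trues ys) a) ⟩
  (suc (trues ys) C suc a) * (falses ys C b)
    ∎
  where open ≡-Reasoning
∑-marked≟ (false ∷ ys) a zero = trans (∑-words-suc bools (length ys) _) $
  cong₂ _+_ (∑-zero (words bools (length ys)) (λ _ → cong 𝟙 (∧-zeroʳ _))) (trans (+-identityʳ _) (∑-marked≟ ys a zero))
∑-marked≟ (false ∷ ys) a (suc b) = trans (∑-words-suc bools (length ys) _) $ begin
  ∑ (words bools (length ys)) (λ ds → 𝟙 (⌊ markedUps ys ds ℕ.≟ a ⌋ ∧ ⌊ suc (markedDowns ys ds) ℕ.≟ suc b ⌋))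
    + (∑ (words bools (length ys)) (λ ds → 𝟙 (⌊ markedUps ys ds ℕ.≟ a ⌋ ∧ ⌊ markedDowns ys ds ℕ.≟ suc b ⌋)) + 0)
    ≡⟨ cong₂ _+_ (trans (∑-cong (words bools (length ys)) (λ ds → cong (λ c → 𝟙 (_ ∧ c)) (≟-suc (markedDowns ys ds) b)))
                        (∑-marked≟ ys a b))
                 (trans (+-identityʳ _) (∑-marked≟ ys a (suc b))) ⟩
  (trues ys C a) * (falses ys C b) + (trues ys C a) * (falses ys C suc b)
    ≡⟨ *-distribˡ-+ (trues ys C a) (falses ys C b) _ ⟨
  (trues ys C a) * (falses ys C b + falses ys C suc b)
    ≡⟨ cong ((trues ys C a) *_) (nCk+nC[k+1]≡[n+1]C[k+1] (falses ys) b) ⟩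
  (trues ys C a) * (suc (falses ys) C suc b)
    ∎
  where open ≡-Reasoning

-- A diagonal walk as a pair of ±1 paths

module _ (f : Bool → Bool → Step) (f-height : ∀ a b → proj₂ (vec (f a b)) ≡ sgn a) where

  height-zipWith : ∀ ys ds → length ys ≡ length ds → proj₂ (E (zipWith f ys ds)) ≡ drift ys
  height-zipWith [] [] _ = refl
  height-zipWith (y ∷ ys) (d ∷ ds) e =
    trans (cong proj₂ (E-∷ (f y d) (zipWith f ys ds))) (cong₂ ℤ._+_ (f-height y d) (height-zipWith ys ds (ℕP.suc-injective e)))

  visits-zipWith : ∀ p h ys ds → length ys ≡ length ds →
    any (λ k → ⌊ proj₂ (endpoint p (take k (zipWith f ys ds))) ℤ.≟ h ⌋) (upTo (suc (length (zipWith f ys ds))))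
      ≡ passesThrough (proj₂ p) h ys
  visits-zipWith p h [] [] _ = ∨-identityʳ _
  visits-zipWith p h (y ∷ ys) (d ∷ ds) e = cong (⌊ proj₂ p ℤ.≟ h ⌋ ∨_) (begin
    any P (applyUpTo (suc ∘ id) (suc (length (zipWith f ys ds))))
      ≡⟨ any-applyUpTo-∘ P suc id (suc (length (zipWith f ys ds))) ⟩
    any (P ∘ suc) (upTo (suc (length (zipWith f ys ds))))
      ≡⟨ visits-zipWith (p ⊕ f y d) h ys ds (ℕP.suc-injective e) ⟩
    passesThrough (proj₂ (p ⊕ f y d)) h ys
      ≡⟨ cong (λ z → passesThrough z h ys) (trans (cong proj₂ (⊕≡⊞vec p (f y d))) (cong (ℤ._+_ (proj₂ p)) (f-height y d))) ⟩
    passesThrough (proj₂ p ℤ.+ sgn y) h ys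
      ∎)
    where
    open ≡-Reasoning
    P : ℕ → Bool
    P k = ⌊ proj₂ (endpoint p (take k (zipWith f (y ∷ ys) (d ∷ ds)))) ℤ.≟ h ⌋

  module _ (f-bij : ∀ (G : Step → ℕ) → ∑ allSteps G ≡ ∑ bools (λ a → ∑ bools (λ b → G (f a b))))
           (Q : List Step → Bool) (L K : ℕ)
           (fibre : ∀ ys → length ys ≡ L → ∑ (words bools L) (λ ds → 𝟙 (Q (zipWith f ys ds))) ≡ K * 𝟙 (isBridge ys)) where

    visitCount-fibre : ∀ h ys → length ys ≡ L →
      ∑ (words bools L) (λ ds → 𝟙 (Q (zipWith f ys ds) ∧ visitsHeight h (zipWith f ys ds)))
        ≡ K * 𝟙 (⌊ + 0 ℤ.+ drift ys ℤ.≟ + 0 ⌋ ∧ passesThrough (+ 0) h ys)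
    visitCount-fibre h ys ∣ys∣≡L = begin
      ∑ (words bools L) (λ ds → 𝟙 (Q (zipWith f ys ds) ∧ visitsHeight h (zipWith f ys ds)))
        ≡⟨ ∑-words-cong bools L (λ ds ∣ds∣≡L →
             trans (cong (λ v → 𝟙 (Q (zipWith f ys ds) ∧ v)) (visits-zipWith origin h ys ds (trans ∣ys∣≡L (sym ∣ds∣≡L))))
                                                      (𝟙-∧ (Q (zipWith f ys ds)) _)) ⟩
      ∑ (words bools L) (λ ds → 𝟙 (Q (zipWith f ys ds)) * 𝟙 passes)
        ≡⟨ ∑-*ʳ (words bools L) (𝟙 passes) (λ ds → 𝟙 (Q (zipWith f ys ds))) ⟩
      ∑ (words bools L) (λ ds → 𝟙 (Q (zipWith f ys ds))) * 𝟙 passes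
        ≡⟨ cong (_* 𝟙 passes) (fibre ys ∣ys∣≡L) ⟩
      K * 𝟙 (isBridge ys) * 𝟙 passes
        ≡⟨ *-assoc K (𝟙 (isBridge ys)) (𝟙 passes) ⟩
      K * (𝟙 (isBridge ys) * 𝟙 passes)
        ≡⟨ cong (K *_) (sym (𝟙-∧ (isBridge ys) passes)) ⟩
      K * 𝟙 (isBridge ys ∧ passes)
        ≡⟨ cong (λ z → K * 𝟙 (⌊ z ℤ.≟ + 0 ⌋ ∧ passes)) (sym (ℤP.+-identityˡ (drift ys))) ⟩
      K * 𝟙 (⌊ + 0 ℤ.+ drift ys ℤ.≟ + 0 ⌋ ∧ passes)
        ∎
      where
      open ≡-Reasoning
      passes = passesThrough (+ 0) h ys

    visitCount≡bridgesVia : ∀ h → ∑ (words allSteps L) (λ w → 𝟙 (Q w ∧ visitsHeight h w)) ≡ K * endingAtVia L (+ 0) h (+ 0)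
    visitCount≡bridgesVia h = begin
      ∑ (words allSteps L) (λ w → 𝟙 (Q w ∧ visitsHeight h w))
        ≡⟨ ∑-words-zipWith f f-bij L _ ⟩
      ∑ (words bools L) (λ ys → ∑ (words bools L) (λ ds → 𝟙 (Q (zipWith f ys ds) ∧ visitsHeight h (zipWith f ys ds))))
        ≡⟨ ∑-words-cong bools L (visitCount-fibre h) ⟩
      ∑ (words bools L) (λ ys → K * 𝟙 (⌊ + 0 ℤ.+ drift ys ℤ.≟ + 0 ⌋ ∧ passesThrough (+ 0) h ys))
        ≡⟨ ∑-*ˡ (words bools L) K _ ⟩
      K * endingAtVia L (+ 0) h (+ 0)
        ∎
      where open ≡-Reasoning

-- The first argument always says whether the step goes up; the second says whether it goes right,
-- resp. whether it lies in {(1,1),(-1,-1)}.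
byCoordinates : Bool → Bool → Step
byCoordinates true true = pp
byCoordinates true false = mp
byCoordinates false true = pm
byCoordinates false false = mm

byDiagonality : Bool → Bool → Step
byDiagonality true true = pp
byDiagonality true false = mp
byDiagonality false true = mm
byDiagonality false false = pm

byCoordinates-height : ∀ a b → proj₂ (vec (byCoordinates a b)) ≡ sgn a
byCoordinates-height true true = refl
byCoordinates-height true false = refl
byCoordinates-height false true = refl
byCoordinates-height false false = refl

byDiagonality-height : ∀ a d → proj₂ (vec (byDiagonality a d)) ≡ sgn a
byDiagonality-height true true = refl
byDiagonality-height true false = refl
byDiagonality-height false true = refl
byDiagonality-height false false = refl

byCoordinates-bij : ∀ (G : Step → ℕ) → ∑ allSteps G ≡ ∑ bools (λ a → ∑ bools (λ b → G (byCoordinates a b)))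
byCoordinates-bij G = regroup (G pp) (G pm) (G mp) (G mm)
  where
  regroup : ∀ p q r s → p + (q + (r + (s + 0))) ≡ (p + (r + 0)) + ((q + (s + 0)) + 0)
  regroup = ℕ-solve-∀

byDiagonality-bij : ∀ (G : Step → ℕ) → ∑ allSteps G ≡ ∑ bools (λ a → ∑ bools (λ d → G (byDiagonality a d)))
byDiagonality-bij G = regroup (G pp) (G pm) (G mp) (G mm)
  where
  regroup : ∀ p q r s → p + (q + (r + (s + 0))) ≡ (p + (r + 0)) + ((s + (q + 0)) + 0)
  regroup = ℕ-solve-∀

E-byCoordinates : ∀ ys xs → length ys ≡ length xs → E (zipWith byCoordinates ys xs) ≡ (drift xs , drift ys)
E-byCoordinates [] [] _ = refl
E-byCoordinates (y ∷ ys) (x ∷ xs) e =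
  trans (E-∷ (byCoordinates y x) (zipWith byCoordinates ys xs))
        (trans (cong (vec (byCoordinates y x) ⊞_) (E-byCoordinates ys xs (ℕP.suc-injective e))) (step y x))
  where
  step : ∀ y x → vec (byCoordinates y x) ⊞ (drift xs , drift ys) ≡ (sgn x ℤ.+ drift xs , sgn y ℤ.+ drift ys)
  step true true = refl
  step true false = refl
  step false true = refl
  step false false = refl

-- x + y rises by 2 on a step (1,1), falls by 2 on a step (-1,-1) and is unchanged otherwise.
x+height-byDiagonality : ∀ ys ds → length ys ≡ length ds →
  proj₁ (E (zipWith byDiagonality ys ds)) ℤ.+ drift ys
    ≡ (+ markedUps ys ds ℤ.- + markedDowns ys ds) ℤ.+ (+ markedUps ys ds ℤ.- + markedDowns ys ds)
x+height-byDiagonality [] [] _ = refl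
x+height-byDiagonality (y ∷ ys) (d ∷ ds) e = begin
  proj₁ (E (s ∷ z)) ℤ.+ (sgn y ℤ.+ drift ys)
    ≡⟨ cong (λ p → proj₁ p ℤ.+ (sgn y ℤ.+ drift ys)) (E-∷ s z) ⟩
  proj₁ (vec s) ℤ.+ proj₁ (E z) ℤ.+ (sgn y ℤ.+ drift ys)
    ≡⟨ interchange (proj₁ (vec s)) (proj₁ (E z)) (sgn y) (drift ys) ⟩
  (proj₁ (vec s) ℤ.+ sgn y) ℤ.+ (proj₁ (E z) ℤ.+ drift ys)
    ≡⟨ cong₂ ℤ._+_ (step y d) (x+height-byDiagonality ys ds (ℕP.suc-injective e)) ⟩
  ((+ u ℤ.- + v) ℤ.+ (+ u ℤ.- + v)) ℤ.+ ((+ U ℤ.- + D) ℤ.+ (+ U ℤ.- + D))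
    ≡⟨ collect (+ u) (+ U) (+ v) (+ D) ⟩
  (+ u ℤ.+ + U ℤ.- (+ v ℤ.+ + D)) ℤ.+ (+ u ℤ.+ + U ℤ.- (+ v ℤ.+ + D))
    ≡⟨ cong₂ (λ p q → (p ℤ.- q) ℤ.+ (p ℤ.- q)) (sym (ℤP.pos-+ u U)) (sym (ℤP.pos-+ v D)) ⟩
  (+ (u + U) ℤ.- + (v + D)) ℤ.+ (+ (u + U) ℤ.- + (v + D))
    ∎
  where
  open ≡-Reasoning
  s = byDiagonality y d
  z = zipWith byDiagonality ys ds
  u = 𝟙 (y ∧ d)
  v = 𝟙 (not y ∧ d)
  U = markedUps ys ds
  D = markedDowns ys ds
  interchange : ∀ a b c d → a ℤ.+ b ℤ.+ (c ℤ.+ d) ≡ (a ℤ.+ c) ℤ.+ (b ℤ.+ d)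
  interchange = solve-∀
  collect : ∀ a b c d → ((a ℤ.- c) ℤ.+ (a ℤ.- c)) ℤ.+ ((b ℤ.- d) ℤ.+ (b ℤ.- d))
                      ≡ (a ℤ.+ b ℤ.- (c ℤ.+ d)) ℤ.+ (a ℤ.+ b ℤ.- (c ℤ.+ d))
  collect = solve-∀
  step : ∀ y d → proj₁ (vec (byDiagonality y d)) ℤ.+ sgn y
                 ≡ (+ 𝟙 (y ∧ d) ℤ.- + 𝟙 (not y ∧ d)) ℤ.+ (+ 𝟙 (y ∧ d) ℤ.- + 𝟙 (not y ∧ d))
  step true true = refl
  step true false = refl
  step false true = refl
  step false false = refl

diagCount-byDiagonality : ∀ ys ds → length ys ≡ length ds →
                          diagCount (zipWith byDiagonality ys ds) ≡ markedUps ys ds + markedDowns ys ds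
diagCount-byDiagonality [] [] _ = refl
diagCount-byDiagonality (true ∷ ys) (true ∷ ds) e = cong suc (diagCount-byDiagonality ys ds (ℕP.suc-injective e))
diagCount-byDiagonality (true ∷ ys) (false ∷ ds) e = diagCount-byDiagonality ys ds (ℕP.suc-injective e)
diagCount-byDiagonality (false ∷ ys) (true ∷ ds) e =
  trans (cong suc (diagCount-byDiagonality ys ds (ℕP.suc-injective e))) (sym (+-suc (markedUps ys ds) (markedDowns ys ds)))
diagCount-byDiagonality (false ∷ ys) (false ∷ ds) e = diagCount-byDiagonality ys ds (ℕP.suc-injective e)

drift≡2⇔ : ∀ {n} xs → length xs ≡ n + n → drift xs ≡ + 2 ⇔ trues xs ≡ suc n
drift≡2⇔ {n} xs ∣xs∣≡2n =
  subst (λ t → drift xs ≡ t ⇔ trues xs ≡ suc n) (sym (two≡ (+ n))) (drift≡double⇔ {n} xs ∣xs∣≡2n)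
  where
  two≡ : ∀ n → + 2 ≡ ((+ 1 ℤ.+ n) ℤ.- n) ℤ.+ ((+ 1 ℤ.+ n) ℤ.- n)
  two≡ = solve-∀

bridge⇒balanced : ∀ {n} ys → length ys ≡ n + n → isBridge ys ≡ true → trues ys ≡ n × falses ys ≡ n
bridge⇒balanced {n} ys ∣ys∣≡2n bridge =
  trues≡n , ℕP.+-cancelˡ-≡ n _ _ (trans (cong (_+ falses ys) (sym trues≡n)) (trans (trues+falses≡length ys) ∣ys∣≡2n))
  where
  zero≡ : ∀ n → + 0 ≡ (n ℤ.- n) ℤ.+ (n ℤ.- n)
  zero≡ = solve-∀
  trues≡n : trues ys ≡ n
  trues≡n = Equivalence.to (drift≡double⇔ {n} ys ∣ys∣≡2n) (trans (⌊⌋-true⁻ (drift ys ℤ.≟ + 0) bridge) (zero≡ (+ n)))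

endsAtTarget-rotate : ∀ j w → endsAt (rotate j w) target ≡ endsAt w target
endsAtTarget-rotate j w = endsAt-rotate j w target

endsAtWithDiagonals : ℕ → List Step → Bool
endsAtWithDiagonals d w = endsAt w target ∧ ⌊ diagCount w ℕ.≟ d ⌋

endsAtWithDiagonals-rotate : ∀ d j w → endsAtWithDiagonals d (rotate j w) ≡ endsAtWithDiagonals d w
endsAtWithDiagonals-rotate d j w = cong₂ (λ b k → b ∧ ⌊ k ℕ.≟ d ⌋) (endsAt-rotate j w target) (diagCount-rotate j w)

endsAtWithDiagonals⇒target : ∀ d w → endsAtWithDiagonals d w ≡ true → E w ≡ target
endsAtWithDiagonals⇒target d w e = endsAt⇒E w (∧-conicalˡ _ _ e)

endsAt-byCoordinates : ∀ {n} ys xs → length ys ≡ length xs → length xs ≡ n + n →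
  endsAt (zipWith byCoordinates ys xs) target ≡ ⌊ trues xs ℕ.≟ suc n ⌋ ∧ isBridge ys
endsAt-byCoordinates {n} ys xs ∣ys∣≡∣xs∣ ∣xs∣≡2n =
  trans (endsAt-E (zipWith byCoordinates ys xs) (E-byCoordinates ys xs ∣ys∣≡∣xs∣))
        (cong (_∧ isBridge ys) (⌊⌋-⇔ (drift xs ℤ.≟ + 2) (trues xs ℕ.≟ suc n) (drift≡2⇔ xs ∣xs∣≡2n)))

fibre-byCoordinates : ∀ n ys → length ys ≡ n + n →
  ∑ (words bools (n + n)) (λ xs → 𝟙 (endsAt (zipWith byCoordinates ys xs) target)) ≡ ((n + n) C suc n) * 𝟙 (isBridge ys)
fibre-byCoordinates n ys ∣ys∣≡2n = begin
  ∑ (words bools (n + n)) (λ xs → 𝟙 (endsAt (zipWith byCoordinates ys xs) target))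
    ≡⟨ ∑-words-cong bools (n + n) (λ xs ∣xs∣≡2n →
         trans (cong 𝟙 (endsAt-byCoordinates ys xs (trans ∣ys∣≡2n (sym ∣xs∣≡2n)) ∣xs∣≡2n)) (𝟙-∧ _ (isBridge ys))) ⟩
  ∑ (words bools (n + n)) (λ xs → 𝟙 ⌊ trues xs ℕ.≟ suc n ⌋ * 𝟙 (isBridge ys))
    ≡⟨ ∑-*ʳ (words bools (n + n)) (𝟙 (isBridge ys)) _ ⟩
  ∑ (words bools (n + n)) (λ xs → 𝟙 ⌊ trues xs ℕ.≟ suc n ⌋) * 𝟙 (isBridge ys)
    ≡⟨ cong (_* 𝟙 (isBridge ys)) (∑-trues≟ (n + n) (suc n)) ⟩
  ((n + n) C suc n) * 𝟙 (isBridge ys)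
    ∎
  where open ≡-Reasoning

diagonalSplit⇔ : ∀ {x u d m} → x ≡ (+ u ℤ.- + d) ℤ.+ (+ u ℤ.- + d) →
                 (x ≡ + 2 × u + d ≡ suc (m + m)) ⇔ (u ≡ suc m × d ≡ m)
diagonalSplit⇔ {x} {u} {d} {m} x≡2[u-d] = mk⇔ to from
  where
  two≡ : ∀ d → + 2 ≡ ((+ 1 ℤ.+ d) ℤ.- d) ℤ.+ ((+ 1 ℤ.+ d) ℤ.- d)
  two≡ = solve-∀
  to : x ≡ + 2 × u + d ≡ suc (m + m) → u ≡ suc m × d ≡ m
  to (x≡2 , u+d≡1+2m) = trans u≡1+d (cong suc d≡m) , d≡m
    where
    u≡1+d : u ≡ suc d
    u≡1+d = ℤP.+-injective (ℤ-+-cancelʳ (ℤ.- + d) (ℤ-double-injective (trans (sym x≡2[u-d]) (trans x≡2 (two≡ (+ d))))))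
    d≡m : d ≡ m
    d≡m = ℤP.+-injective (ℤ-double-injective (trans (sym (ℤP.pos-+ d d))
            (trans (cong +_ (ℕP.suc-injective (trans (cong (_+ d) (sym u≡1+d)) u+d≡1+2m))) (ℤP.pos-+ m m))))
  from : u ≡ suc m × d ≡ m → x ≡ + 2 × u + d ≡ suc (m + m)
  from (refl , refl) = trans x≡2[u-d] (sym (two≡ (+ d))) , refl

endsAtWithDiagonals-byDiagonality : ∀ m ys ds → length ys ≡ length ds →
  endsAtWithDiagonals (suc (m + m)) (zipWith byDiagonality ys ds)
    ≡ (⌊ markedUps ys ds ℕ.≟ suc m ⌋ ∧ ⌊ markedDowns ys ds ℕ.≟ m ⌋) ∧ isBridge ys
endsAtWithDiagonals-byDiagonality m ys ds ∣ys∣≡∣ds∣ = ⇔→≡ {z = true} (mk⇔ to from)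
  where
  z = zipWith byDiagonality ys ds
  U = markedUps ys ds
  D = markedDowns ys ds
  x = proj₁ (E z)
  endsAt≡ : endsAt z target ≡ ⌊ x ℤ.≟ + 2 ⌋ ∧ isBridge ys
  endsAt≡ = endsAt-E z (cong (x ,_) (height-zipWith byDiagonality byDiagonality-height ys ds ∣ys∣≡∣ds∣))
  diag≡ : diagCount z ≡ U + D
  diag≡ = diagCount-byDiagonality ys ds ∣ys∣≡∣ds∣
  bridge⇒x≡ : isBridge ys ≡ true → x ≡ (+ U ℤ.- + D) ℤ.+ (+ U ℤ.- + D)
  bridge⇒x≡ bridge = trans (sym (ℤP.+-identityʳ x))
    (trans (cong (ℤ._+_ x) (sym (⌊⌋-true⁻ (drift ys ℤ.≟ + 0) bridge))) (x+height-byDiagonality ys ds ∣ys∣≡∣ds∣))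
  to : endsAtWithDiagonals (suc (m + m)) z ≡ true → (⌊ U ℕ.≟ suc m ⌋ ∧ ⌊ D ℕ.≟ m ⌋) ∧ isBridge ys ≡ true
  to e = cong₂ _∧_ (cong₂ _∧_ (⌊⌋-true (U ℕ.≟ suc m) (proj₁ split)) (⌊⌋-true (D ℕ.≟ m) (proj₂ split))) bridge
    where
    ends = trans (sym endsAt≡) (∧-conicalˡ _ _ e)
    bridge = ∧-conicalʳ _ _ ends
    split = Equivalence.to (diagonalSplit⇔ (bridge⇒x≡ bridge))
              (⌊⌋-true⁻ (x ℤ.≟ + 2) (∧-conicalˡ _ _ ends)
              , trans (sym diag≡) (⌊⌋-true⁻ (diagCount z ℕ.≟ _) (∧-conicalʳ _ _ e)))
  from : (⌊ U ℕ.≟ suc m ⌋ ∧ ⌊ D ℕ.≟ m ⌋) ∧ isBridge ys ≡ true → endsAtWithDiagonals (suc (m + m)) z ≡ true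
  from e = cong₂ _∧_ (trans endsAt≡ (cong₂ _∧_ (⌊⌋-true (x ℤ.≟ + 2) (proj₁ unsplit)) bridge))
                     (⌊⌋-true (diagCount z ℕ.≟ _) (trans diag≡ (proj₂ unsplit)))
    where
    counts = ∧-conicalˡ _ (isBridge ys) e
    bridge = ∧-conicalʳ _ (isBridge ys) e
    unsplit = Equivalence.from (diagonalSplit⇔ (bridge⇒x≡ bridge))
                (⌊⌋-true⁻ (U ℕ.≟ suc m) (∧-conicalˡ _ _ counts) , ⌊⌋-true⁻ (D ℕ.≟ m) (∧-conicalʳ _ _ counts))

fibre-byDiagonality : ∀ n m ys → length ys ≡ n + n →
  ∑ (words bools (n + n)) (λ ds → 𝟙 (endsAtWithDiagonals (suc (m + m)) (zipWith byDiagonality ys ds)))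
    ≡ ((n C suc m) * (n C m)) * 𝟙 (isBridge ys)
fibre-byDiagonality n m ys ∣ys∣≡2n = begin
  ∑ (words bools (n + n)) (λ ds → 𝟙 (endsAtWithDiagonals (suc (m + m)) (zipWith byDiagonality ys ds)))
    ≡⟨ ∑-words-cong bools (n + n) (λ ds ∣ds∣≡2n →
         trans (cong 𝟙 (endsAtWithDiagonals-byDiagonality m ys ds (trans ∣ys∣≡2n (sym ∣ds∣≡2n)))) (𝟙-∧ _ (isBridge ys))) ⟩
  ∑ (words bools (n + n)) (λ ds → 𝟙 (marked ds) * 𝟙 (isBridge ys))
    ≡⟨ ∑-*ʳ (words bools (n + n)) (𝟙 (isBridge ys)) (𝟙 ∘ marked) ⟩
  ∑ (words bools (n + n)) (𝟙 ∘ marked) * 𝟙 (isBridge ys)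
    ≡⟨ cong (λ L → ∑ (words bools L) (𝟙 ∘ marked) * 𝟙 (isBridge ys)) (sym ∣ys∣≡2n) ⟩
  ∑ (words bools (length ys)) (𝟙 ∘ marked) * 𝟙 (isBridge ys)
    ≡⟨ cong (_* 𝟙 (isBridge ys)) (∑-marked≟ ys (suc m) m) ⟩
  ((trues ys C suc m) * (falses ys C m)) * 𝟙 (isBridge ys)
    ≡⟨ balanced ⟩
  ((n C suc m) * (n C m)) * 𝟙 (isBridge ys)
    ∎
  where
  open ≡-Reasoning
  marked : List Bool → Bool
  marked ds = ⌊ markedUps ys ds ℕ.≟ suc m ⌋ ∧ ⌊ markedDowns ys ds ℕ.≟ m ⌋
  balanced : ((trues ys C suc m) * (falses ys C m)) * 𝟙 (isBridge ys) ≡ ((n C suc m) * (n C m)) * 𝟙 (isBridge ys)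
  balanced with isBridge ys in bridge
  ... | false = trans (*-zeroʳ ((trues ys C suc m) * (falses ys C m))) (sym (*-zeroʳ ((n C suc m) * (n C m))))
  ... | true with trues≡n , falses≡n ← bridge⇒balanced {n} ys ∣ys∣≡2n bridge =
    cong₂ (λ t f → ((t C suc m) * (f C m)) * 1) trues≡n falses≡n

module _ (f : Bool → Bool → Step) (f-height : ∀ a b → proj₂ (vec (f a b)) ≡ sgn a)
         (f-bij : ∀ (G : Step → ℕ) → ∑ allSteps G ≡ ∑ bools (λ a → ∑ bools (λ b → G (f a b))))
         (Q : List Step → Bool) (Q-rotate : ∀ j w → Q (rotate j w) ≡ Q w) (Q⇒target : ∀ w → Q w ≡ true → E w ≡ target)
         (n K : ℕ)
         (fibre : ∀ ys → length ys ≡ n + n → ∑ (words bools (n + n)) (λ ds → 𝟙 (Q (zipWith f ys ds))) ≡ K * 𝟙 (isBridge ys))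
         where

  slitCount-byFibres : (n + n) * ∑ (words allSteps (n + n)) (λ w → 𝟙 (onSlitPlane w ∧ Q w)) ≡ K * 4 ^ n
  slitCount-byFibres = begin
    (n + n) * ∑ (words allSteps (n + n)) (λ w → 𝟙 (onSlitPlane w ∧ Q w))
      ≡⟨ slitCount≡visitedHeights Q Q-rotate Q⇒target (n + n) ⟩
    ∑ (symmetricRange (n + n)) (λ h → ∑ (words allSteps (n + n)) (λ w → 𝟙 (Q w ∧ visitsHeight h w)))
      ≡⟨ ∑-cong (symmetricRange (n + n)) (visitCount≡bridgesVia f f-height f-bij Q (n + n) K fibre) ⟩
    ∑ (symmetricRange (n + n)) (λ h → K * endingAtVia (n + n) (+ 0) h (+ 0))
      ≡⟨ ∑-*ˡ (symmetricRange (n + n)) K _ ⟩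
    K * ∑ (symmetricRange (n + n)) (λ h → endingAtVia (n + n) (+ 0) h (+ 0))
      ≡⟨ cong (K *_) (trans (∑-bridgesVia n) (2^[n+n]≡4^n n)) ⟩
    K * 4 ^ n
      ∎
    where open ≡-Reasoning

-- Catalan numbers

[1+k]*[1+n]C[1+k]≡[1+n]*nCk : ∀ n k → suc k * (suc n C suc k) ≡ suc n * (n C k)
[1+k]*[1+n]C[1+k]≡[1+n]*nCk zero zero = refl
[1+k]*[1+n]C[1+k]≡[1+n]*nCk zero (suc k) = *-zeroʳ (suc (suc k))
[1+k]*[1+n]C[1+k]≡[1+n]*nCk (suc n) zero = trans (+-identityʳ _) (trans (nC1≡n (suc (suc n))) (sym (*-identityʳ (suc (suc n)))))
[1+k]*[1+n]C[1+k]≡[1+n]*nCk (suc n) (suc k) = begin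
  suc (suc k) * (suc (suc n) C suc (suc k))
    ≡⟨ cong (suc (suc k) *_) (nCk+nC[k+1]≡[n+1]C[k+1] (suc n) (suc k)) ⟨
  suc (suc k) * (c₁ + c₂)
    ≡⟨ *-distribˡ-+ (suc (suc k)) c₁ c₂ ⟩
  c₁ + suc k * c₁ + suc (suc k) * c₂
    ≡⟨ cong₂ (λ a b → c₁ + a + b) ([1+k]*[1+n]C[1+k]≡[1+n]*nCk n k) ([1+k]*[1+n]C[1+k]≡[1+n]*nCk n (suc k)) ⟩
  c₁ + suc n * (n C k) + suc n * (n C suc k)
    ≡⟨ +-assoc c₁ _ _ ⟩
  c₁ + (suc n * (n C k) + suc n * (n C suc k))
    ≡⟨ cong (_+_ c₁) (*-distribˡ-+ (suc n) (n C k) (n C suc k)) ⟨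
  c₁ + suc n * (n C k + n C suc k)
    ≡⟨ cong (λ a → c₁ + suc n * a) (nCk+nC[k+1]≡[n+1]C[k+1] n k) ⟩
  suc (suc n) * c₁
    ∎
  where
  open ≡-Reasoning
  c₁ = suc n C suc k
  c₂ = suc n C suc (suc k)

[1+n]*2nC[1+n]≡n*2nCn : ∀ n → suc n * ((n + n) C suc n) ≡ n * ((n + n) C n)
[1+n]*2nC[1+n]≡n*2nCn zero = refl
[1+n]*2nC[1+n]≡n*2nCn (suc p) = begin
  suc (suc p) * ((suc p + suc p) C suc (suc p))
    ≡⟨ cong (λ i → suc (suc p) * (i C suc (suc p))) 2+2p≡1+N ⟩
  suc (suc p) * (suc N C suc (suc p))
    ≡⟨ [1+k]*[1+n]C[1+k]≡[1+n]*nCk N (suc p) ⟩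
  suc N * (N C suc p)
    ≡⟨ cong (suc N *_) NC[1+p]≡NCp ⟩
  suc N * (N C p)
    ≡⟨ [1+k]*[1+n]C[1+k]≡[1+n]*nCk N p ⟨
  suc p * (suc N C suc p)
    ≡⟨ cong (λ i → suc p * (i C suc p)) 2+2p≡1+N ⟨
  suc p * ((suc p + suc p) C suc p)
    ∎
  where
  open ≡-Reasoning
  N = suc (p + p)
  2+2p≡1+N : suc p + suc p ≡ suc N
  2+2p≡1+N = cong suc (+-suc p p)
  NC[1+p]≡NCp : N C suc p ≡ N C p
  NC[1+p]≡NCp = trans (nCk≡nC[n∸k] (s≤s (ℕP.m≤n+m p p))) (cong (N C_) (ℕP.m+n∸m≡n p p))

binomials≡catalan : ∀ n → (n + n) C n ≡ suc n * catalan n × (n + n) C suc n ≡ n * catalan n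
binomials≡catalan n = subst (λ c → B₀ ≡ suc n * c × B₁ ≡ n * c) (sym catalan≡D) (B₀≡[1+n]D , B₁≡nD)
  where
  B₀ = (n + n) C n
  B₁ = (n + n) C suc n
  D = B₀ ∸ B₁
  ballot = [1+n]*2nC[1+n]≡n*2nCn n
  B₀≡[1+n]D : B₀ ≡ suc n * D
  B₀≡[1+n]D =
    sym (trans (ℕP.*-distribˡ-∸ (suc n) B₀ B₁) (trans (cong (suc n * B₀ ∸_) ballot) (ℕP.m+n∸n≡m B₀ (n * B₀))))
  B₁≡nD : B₁ ≡ n * D
  B₁≡nD = sym (trans (ℕP.*-distribˡ-∸ n B₀ B₁) (trans (cong (_∸ n * B₁) (sym ballot)) (ℕP.m+n∸n≡m B₁ (n * B₁))))
  catalan≡D : catalan n ≡ D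
  catalan≡D = trans (cong (λ i → (i C n) / suc n) (2*n≡n+n n))
                    (trans (cong (_/ suc n) (trans B₀≡[1+n]D (*-comm (suc n) D))) (m*n/n≡m D (suc n)))

[n+n]*count≡ : ∀ n → (n + n) * count n ≡ ((n + n) C suc n) * 4 ^ n
[n+n]*count≡ n = trans (cong (_*_ (n + n)) (count-allWalks n _))
  (slitCount-byFibres byCoordinates byCoordinates-height byCoordinates-bij (λ w → endsAt w target) endsAtTarget-rotate
                      (λ w → endsAt⇒E w) n ((n + n) C suc n) (fibre-byCoordinates n))

[n+n]*countDiag≡ : ∀ n m → (n + n) * countDiag n (suc (m + m)) ≡ ((n C suc m) * (n C m)) * 4 ^ n
[n+n]*countDiag≡ n m = trans (cong (_*_ (n + n)) (count-allWalks n _))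
  (slitCount-byFibres byDiagonality byDiagonality-height byDiagonality-bij (endsAtWithDiagonals (suc (m + m)))
                      (endsAtWithDiagonals-rotate _) (endsAtWithDiagonals⇒target _) n ((n C suc m) * (n C m)) (fibre-byDiagonality n m))

proposition3p7 : (∀ (n : ℕ) → 1 ≤ n → 2 * count n ≡ 4 ^ n * catalan n)
    × (∀ (n m : ℕ) → 1 ≤ m → m ≤ n →
    2 * n * countDiag n (2 * m ∸ 1) ≡ 4 ^ n * ((n C m) * (n C (m ∸ 1))))
proposition3p7 = part₁ , part₂
  where
  open ≡-Reasoning
  n*[2*c]≡[n+n]*c : ∀ n c → n * (2 * c) ≡ (n + n) * c
  n*[2*c]≡[n+n]*c = ℕ-solve-∀
  n*c*q≡n*[q*c] : ∀ n c q → n * c * q ≡ n * (q * c)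
  n*c*q≡n*[q*c] = ℕ-solve-∀
  part₁ : ∀ n → 1 ≤ n → 2 * count n ≡ 4 ^ n * catalan n
  part₁ n@(suc _) _ = ℕP.*-cancelˡ-≡ _ _ n (begin
    n * (2 * count n)          ≡⟨ n*[2*c]≡[n+n]*c n (count n) ⟩
    (n + n) * count n          ≡⟨ [n+n]*count≡ n ⟩
    ((n + n) C suc n) * 4 ^ n  ≡⟨ cong (_* 4 ^ n) (proj₂ (binomials≡catalan n)) ⟩
    n * catalan n * 4 ^ n      ≡⟨ n*c*q≡n*[q*c] n (catalan n) (4 ^ n) ⟩
    n * (4 ^ n * catalan n)    ∎)
  part₂ : ∀ n m → 1 ≤ m → m ≤ n → 2 * n * countDiag n (2 * m ∸ 1) ≡ 4 ^ n * ((n C m) * (n C (m ∸ 1)))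
  part₂ n (suc m) _ _ = begin
    2 * n * countDiag n (2 * suc m ∸ 1)  ≡⟨ cong₂ (λ a d → a * countDiag n d) (2*n≡n+n n) (2*[1+m]∸1≡1+2m m) ⟩
    (n + n) * countDiag n (suc (m + m))  ≡⟨ [n+n]*countDiag≡ n m ⟩
    ((n C suc m) * (n C m)) * 4 ^ n      ≡⟨ *-comm ((n C suc m) * (n C m)) (4 ^ n) ⟩
    4 ^ n * ((n C suc m) * (n C m))      ∎
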